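{- Let $r\ge 2$ and $\delta\ge 2r-2$ be integers. For every positive integer $p$ there is a connected $(2r-1)$-colorable (hence $K_{2r}$-free) graph $G_{r,\delta,p}$ of minimum degree $\delta$ and order $n=p\bigl((2r-1)\delta+2r-3\bigr)+2$, whose diameter is $\frac{(6r-5)n}{(2r-1)\delta+2r-3}+O(1)$ (the $O(1)$ term being bounded by a constant independent of $p$, $n$ and $\delta$). Moreover, \[\frac{(6r-5)\delta}{(2r-1)\delta+2r-3}>\frac{2(r-1)(3r+2)}{2r^2-1}\quad\text{if and only if}\quad \delta>12r^3-22r^2-2r+12=2(r-1)(3r+2)(2r-3),\] so for such $\delta$ these graphs have diameter exceeding $\frac{2(r-1)(3r+2)}{2r^2-1}\cdot\frac{n}{\delta}+O(1)$ as $p\to\infty$; and the difference $\frac{(6r-5)\delta}{(2r-1)\delta+2r-3}-\frac{2(r-1)(3r+2)}{2r^2-1}$ equals $\frac{1}{(2r^2-1)(2r-1)}+o(1)$ as $\delta\to\infty$.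
   Context: A graph is $K_{2r}$-free if it contains no complete subgraph on $2r$ vertices. The diameter is the maximum distance between two vertices. -}

module Defs where

open import Data.Nat using (ℕ; zero; suc; _+_; _*_; _≤_; _<_)
open import Data.Bool using (Bool; true; false)
open import Data.Fin using (Fin)
open import Data.List using (List; length; filterᵇ; allFin)
open import Data.Product using (Σ; ∃; _×_)
open import Data.Integer using (ℤ)
open import Data.Rational using (ℚ; 0ℚ; _/_)
open import Relation.Binary.PropositionalEquality using (_≡_; _≢_)
open import Relation.Nullary using (¬_)

record Graph (n : ℕ) : Set where
  field
    adj   : Fin n → Fin n → Bool
    sym   : ∀ u v → adj u v ≡ adj v u
    loopless : ∀ v → adj v v ≡ false
open Graph public

Adj : ∀ {n} → Graph n → Fin n → Fin n → Set
Adj G u v = adj G u v ≡ true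

degree : ∀ {n} → Graph n → Fin n → ℕ
degree {n} G v = length (filterᵇ (adj G v) (allFin n))

MinDegree : ∀ {n} → Graph n → ℕ → Set
MinDegree {n} G δ = (∀ v → δ ≤ degree G v) × (∃ λ v → degree G v ≡ δ)

data Reach {n : ℕ} (G : Graph n) : ℕ → Fin n → Fin n → Set where
  here : ∀ {k u} → Reach G k u u
  step : ∀ {k u w v} → Adj G u w → Reach G k w v → Reach G (suc k) u v

Connected : ∀ {n} → Graph n → Set
Connected G = ∀ u v → ∃ λ k → Reach G k u v

IsDiameter : ∀ {n} → Graph n → ℕ → Set
IsDiameter G D =
  (∀ u v → Reach G D u v) ×
  (∃ λ u → ∃ λ v → ∀ k → k < D → ¬ Reach G k u v)

Colorable : ∀ {n} → Graph n → ℕ → Set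
Colorable {n} G c = Σ (Fin n → Fin c) λ col → ∀ u v → Adj G u v → col u ≢ col v

-- rational a/b (b = 0 mapped to 0; only used with positive denominators)
frac : ℤ → ℕ → ℚ
frac a zero = 0ℚ
frac a (suc b) = a / suc b

-- G_{r,δ,p} is a layered graph: the vertices are split into layers V₀, …, V_{L-1}, each layer
-- into classes, and two vertices are adjacent when they lie in consecutive layers or in different
-- classes of one layer.  Every walk changes the layer index by at most one per step while layers
-- are joined completely, so the diameter is L - 1; a vertex of a class X of V_ℓ has degree
-- |V_{ℓ-1}| + |V_ℓ| + |V_{ℓ+1}| - |X|; and numbering the classes consecutively modulo k is a
-- proper colouring once any two consecutive layers have at most k classes together.
-- With K = 2r - 3 the graph consists of p blocks of 6r - 5 layers S_j T_j H_j (j ≤ K), S_{K+1}: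
-- the S_j are single vertices, and T_j, H_j split the nearly equal parts of δ into K + 2 classes in
-- total, so that at most 2r - 1 colours are needed, every window of three layers around a class X
-- has at least δ + |X| vertices, and windows around the S_j have exactly δ + 1.  The three
-- statements about fractions reduce, after cross-multiplication, to
-- (6r - 5)(2r² - 1) = 2(r - 1)(3r + 2)(2r - 1) + 1.

module Submission where

open import Data.Bool using (Bool; true; false; not; _∧_; _∨_; if_then_else_)
open import Data.Bool.Properties using (∧-identityʳ; ∧-zeroʳ; ∨-identityʳ; ∨-zeroʳ; ∧-conicalˡ)
open import Data.Empty using (⊥-elim)
open import Data.Fin using (Fin; toℕ; fromℕ<)
open import Data.Fin.Properties using (toℕ<n; toℕ-fromℕ<)
open import Data.List using (length; filterᵇ; tabulate)
open import Data.Nat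
open import Data.Nat.DivMod using (_%_; _/_; _mod_; m≡m%n+[m/n]*n; m%n<n)
open import Data.Nat.GeneralisedArithmetic using (fold; fold-+)
open import Data.Nat.Properties
open import Algebra.Properties.CommutativeSemigroup +-commutativeSemigroup using (interchange)
open import Data.Nat.Tactic.RingSolver using (solve-∀)
open import Data.Product using (Σ; ∃; _×_; _,_; proj₁; proj₂; uncurry′)
open import Data.Sum using (_⊎_; inj₁; inj₂)
open import Function using (_∘_; _⇔_; mk⇔; Equivalence)
import Function.Properties.Equivalence as ⇔
open import Relation.Binary using (tri<; tri≈; tri>)
open import Relation.Binary.PropositionalEquality
open import Relation.Nullary using (Dec; yes; no; does; ¬_; _×-dec_; _⊎-dec_; ¬?)
open import Relation.Nullary.Decidable using (dec-true; dec-false; does-⇔)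

open import Defs hiding (sym)

-- Finite sums and counting

∑ : ℕ → (ℕ → ℕ) → ℕ
∑ zero    f = 0
∑ (suc n) f = f 0 + ∑ n (f ∘ suc)

∑-cong : ∀ n {f g : ℕ → ℕ} → (∀ x → x < n → f x ≡ g x) → ∑ n f ≡ ∑ n g
∑-cong zero    eq = refl
∑-cong (suc n) eq = cong₂ _+_ (eq 0 z<s) (∑-cong n (λ x x<n → eq (suc x) (s<s x<n)))

∑-+ : ∀ m n (f : ℕ → ℕ) → ∑ (m + n) f ≡ ∑ m f + ∑ n (λ x → f (m + x))
∑-+ zero    n f = refl
∑-+ (suc m) n f = trans (cong (f 0 +_) (∑-+ m n (f ∘ suc))) (sym (+-assoc (f 0) _ _))

∑-suc : ∀ n (f : ℕ → ℕ) → ∑ (suc n) f ≡ ∑ n f + f n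
∑-suc n f = begin
  ∑ (suc n) f                        ≡⟨ cong (λ m → ∑ m f) (+-comm 1 n) ⟩
  ∑ (n + 1) f                        ≡⟨ ∑-+ n 1 f ⟩
  ∑ n f + (f (n + 0) + 0)            ≡⟨ cong (λ t → ∑ n f + t) (trans (+-identityʳ _) (cong f (+-identityʳ n))) ⟩
  ∑ n f + f n                        ∎
  where open ≡-Reasoning

∑-distrib-+ : ∀ n (f g : ℕ → ℕ) → ∑ n (λ x → f x + g x) ≡ ∑ n f + ∑ n g
∑-distrib-+ zero    f g = refl
∑-distrib-+ (suc n) f g = begin
  f 0 + g 0 + ∑ n (λ x → f (suc x) + g (suc x))    ≡⟨ cong (f 0 + g 0 +_) (∑-distrib-+ n (f ∘ suc) (g ∘ suc)) ⟩
  f 0 + g 0 + (∑ n (f ∘ suc) + ∑ n (g ∘ suc))      ≡⟨ interchange (f 0) (g 0) _ _ ⟩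
  f 0 + ∑ n (f ∘ suc) + (g 0 + ∑ n (g ∘ suc))      ∎
  where open ≡-Reasoning

∑-const : ∀ n c → ∑ n (λ _ → c) ≡ n * c
∑-const zero    c = refl
∑-const (suc n) c = cong (c +_) (∑-const n c)

∑-blocks : ∀ b P (f : ℕ → ℕ) → ∑ (b * P) f ≡ ∑ b (λ i → ∑ P (λ o → f (i * P + o)))
∑-blocks zero    P f = refl
∑-blocks (suc b) P f = begin
  ∑ (P + b * P) f                                          ≡⟨ cong (λ n → ∑ n f) (+-comm P (b * P)) ⟩
  ∑ (b * P + P) f                                          ≡⟨ ∑-+ (b * P) P f ⟩
  ∑ (b * P) f + ∑ P (λ o → f (b * P + o))                  ≡⟨ cong (_+ ∑ P (λ o → f (b * P + o))) (∑-blocks b P f) ⟩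
  ∑ b (λ i → ∑ P (λ o → f (i * P + o))) + ∑ P (λ o → f (b * P + o))
                                                           ≡⟨ sym (∑-suc b (λ i → ∑ P (λ o → f (i * P + o)))) ⟩
  ∑ (suc b) (λ i → ∑ P (λ o → f (i * P + o)))              ∎
  where open ≡-Reasoning

∑-monoˡ-≤ : ∀ (f : ℕ → ℕ) {m n} → m ≤ n → ∑ m f ≤ ∑ n f
∑-monoˡ-≤ f {zero}  m≤n       = z≤n
∑-monoˡ-≤ f {suc m} (s≤s m≤n) = +-monoʳ-≤ (f 0) (∑-monoˡ-≤ (f ∘ suc) m≤n)

term≤∑ : ∀ n (f : ℕ → ℕ) {x} → x < n → f x ≤ ∑ n f
term≤∑ (suc n) f {zero}  _         = m≤m+n (f 0) _
term≤∑ (suc n) f {suc x} (s≤s x<n) = ≤-trans (term≤∑ n (f ∘ suc) x<n) (m≤n+m _ (f 0))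

does-true⇒ : ∀ {A : Set} (a? : Dec A) → does a? ≡ true → A
does-true⇒ (yes a) _ = a

𝟙 : Bool → ℕ
𝟙 true  = 1
𝟙 false = 0

count : ℕ → (ℕ → Bool) → ℕ
count n P = ∑ n (𝟙 ∘ P)

count-< : ∀ {b n} → b ≤ n → count n (λ x → does (x <? b)) ≡ b
count-< {zero}  {n}     _         = trans (∑-const n 0) (*-zeroʳ n)
count-< {suc b} {suc n} (s≤s b≤n) = cong suc (count-< b≤n)

count-∧-not : ∀ n (P Q : ℕ → Bool) → (∀ x → x < n → Q x ≡ true → P x ≡ true) →
              count n (λ x → P x ∧ not (Q x)) ≡ count n P ∸ count n Q
count-∧-not n P Q Q⊆P = trans (sym (m+n∸n≡m _ (count n Q)))
  (cong (_∸ count n Q) (trans (sym (∑-distrib-+ n _ _)) (∑-cong n pointwise)))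
  where
  pointwise : ∀ x → x < n → 𝟙 (P x ∧ not (Q x)) + 𝟙 (Q x) ≡ 𝟙 (P x)
  pointwise x x<n with P x | Q x | Q⊆P x x<n
  ... | true  | true  | _ = refl
  ... | true  | false | _ = refl
  ... | false | false | _ = refl
  ... | false | true  | q⇒p with q⇒p refl
  ...   | ()

∑-shrinkLast : ∀ n (f : ℕ → ℕ) e → 0 < f n →
               ∑ (suc n) (λ c → f c ∸ 𝟙 (e ∧ does (c ≟ n))) + 𝟙 e ≡ ∑ (suc n) f
∑-shrinkLast n f e 0<fn = begin
  ∑ (suc n) (λ c → f c ∸ 𝟙 (e ∧ does (c ≟ n))) + 𝟙 e
    ≡⟨ cong (_+ 𝟙 e) (∑-suc n _) ⟩
  ∑ n (λ c → f c ∸ 𝟙 (e ∧ does (c ≟ n))) + (f n ∸ 𝟙 (e ∧ does (n ≟ n))) + 𝟙 e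
    ≡⟨ cong₂ (λ a t → a + (f n ∸ 𝟙 t) + 𝟙 e) (∑-cong n untouched) (trans (cong (e ∧_) (dec-true (n ≟ n) refl)) (∧-identityʳ e)) ⟩
  ∑ n f + (f n ∸ 𝟙 e) + 𝟙 e
    ≡⟨ +-assoc (∑ n f) _ _ ⟩
  ∑ n f + (f n ∸ 𝟙 e + 𝟙 e)
    ≡⟨ cong (∑ n f +_) (m∸n+n≡m (≤-trans (𝟙≤1 e) 0<fn)) ⟩
  ∑ n f + f n
    ≡⟨ sym (∑-suc n f) ⟩
  ∑ (suc n) f
    ∎
  where
  open ≡-Reasoning
  𝟙≤1 : ∀ e → 𝟙 e ≤ 1
  𝟙≤1 true  = ≤-refl
  𝟙≤1 false = z≤n
  untouched : ∀ c → c < n → f c ∸ 𝟙 (e ∧ does (c ≟ n)) ≡ f c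
  untouched c c<n = cong (λ t → f c ∸ 𝟙 t) (trans (cong (e ∧_) (dec-false (c ≟ n) (<⇒≢ c<n))) (∧-zeroʳ e))

_∈[_,_⟩? : ∀ x a b → Dec (a ≤ x × x < b)
x ∈[ a , b ⟩? = (a ≤? x) ×-dec (x <? b)

count-interval : ∀ {a b n} → a ≤ b → b ≤ n → count n (λ x → does (x ∈[ a , b ⟩?)) ≡ b ∸ a
count-interval {a} {b} {n} a≤b b≤n =
  trans (sym (m+n∸n≡m _ a)) (cong (_∸ a) (begin
    count n (λ x → does (x ∈[ a , b ⟩?)) + a
      ≡⟨ cong (count n (λ x → does (x ∈[ a , b ⟩?)) +_) (sym (count-< (≤-trans a≤b b≤n))) ⟩
    count n (λ x → does (x ∈[ a , b ⟩?)) + count n (λ x → does (x <? a))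
      ≡⟨ sym (∑-distrib-+ n _ _) ⟩
    ∑ n (λ x → 𝟙 (does (x ∈[ a , b ⟩?)) + 𝟙 (does (x <? a)))
      ≡⟨ ∑-cong n (λ x _ → split x) ⟩
    count n (λ x → does (x <? b))
      ≡⟨ count-< b≤n ⟩
    b ∎))
  where
  open ≡-Reasoning
  split : ∀ x → 𝟙 (does (x ∈[ a , b ⟩?)) + 𝟙 (does (x <? a)) ≡ 𝟙 (does (x <? b))
  split x = by-cases (a ≤? x) (x <? b) (x <? a)
    where
    by-cases : (p : Dec (a ≤ x)) (q : Dec (x < b)) (r : Dec (x < a)) →
               𝟙 (does (p ×-dec q)) + 𝟙 (does r) ≡ 𝟙 (does q)
    by-cases (yes a≤x) _        (yes x<a) = ⊥-elim (<⇒≱ x<a a≤x)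
    by-cases (yes _)   (yes _)  (no _)    = refl
    by-cases (yes _)   (no _)   (no _)    = refl
    by-cases (no _)    (yes _)  (yes _)   = refl
    by-cases (no _)    (no x≮b) (yes x<a) = ⊥-elim (x≮b (<-≤-trans x<a a≤b))
    by-cases (no a≰x)  _        (no x≮a)  = ⊥-elim (a≰x (≮⇒≥ x≮a))

locate : ℕ → (ℕ → ℕ) → ℕ → ℕ
locate zero    f x = 0
locate (suc n) f x with x <? f 0
... | yes _ = 0
... | no  _ = suc (locate n (f ∘ suc) (x ∸ f 0))

Located : ℕ → (ℕ → ℕ) → ℕ → ℕ → Set
Located n f x i = i < n × ∑ i f ≤ x × x < ∑ (suc i) f

locate-correct : ∀ n f x → x < ∑ n f → Located n f x (locate n f x)
locate-correct (suc n) f x x<∑ with x <? f 0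
... | yes x<f0 = z<s , z≤n , subst (x <_) (sym (+-identityʳ (f 0))) x<f0
... | no  x≮f0 with locate-correct n (f ∘ suc) (x ∸ f 0) x-f0<∑
  where
  x-f0<∑ : x ∸ f 0 < ∑ n (f ∘ suc)
  x-f0<∑ = +-cancelˡ-< (f 0) _ _ (subst (_< ∑ (suc n) f) (sym (m+[n∸m]≡n (≮⇒≥ x≮f0))) x<∑)
...   | i<n , lower , upper =
  s<s i<n ,
  subst (f 0 + ∑ i′ (f ∘ suc) ≤_) f0+[x∸f0]≡x (+-monoʳ-≤ (f 0) lower) ,
  subst (_< f 0 + ∑ (suc i′) (f ∘ suc)) f0+[x∸f0]≡x (+-monoʳ-< (f 0) upper)
  where
  i′ : ℕ
  i′ = locate n (f ∘ suc) (x ∸ f 0)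
  f0+[x∸f0]≡x : f 0 + (x ∸ f 0) ≡ x
  f0+[x∸f0]≡x = m+[n∸m]≡n (≮⇒≥ x≮f0)

locate-unique : ∀ n f x i → Located n f x i → locate n f x ≡ i
locate-unique (suc n) f x zero (_ , _ , upper) with x <? f 0
... | yes _    = refl
... | no x≮f0 = ⊥-elim (x≮f0 (subst (x <_) (+-identityʳ (f 0)) upper))
locate-unique (suc n) f x (suc i) (s≤s i<n , lower , upper) with x <? f 0
... | yes x<f0 = ⊥-elim (<⇒≱ x<f0 (≤-trans (m≤m+n (f 0) _) lower))
... | no  x≮f0 = cong suc (locate-unique n (f ∘ suc) (x ∸ f 0) i (i<n , lower′ , upper′))
  where
  shift : x ≡ f 0 + (x ∸ f 0)
  shift = sym (m+[n∸m]≡n (≮⇒≥ x≮f0))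
  lower′ : ∑ i (f ∘ suc) ≤ x ∸ f 0
  lower′ = +-cancelˡ-≤ (f 0) _ _ (subst (f 0 + ∑ i (f ∘ suc) ≤_) shift lower)
  upper′ : x ∸ f 0 < ∑ (suc i) (f ∘ suc)
  upper′ = +-cancelˡ-< (f 0) _ _ (subst (_< f 0 + ∑ (suc i) (f ∘ suc)) shift upper)

count-≟ : ∀ {a n} → a < n → count n (λ x → does (x ≟ a)) ≡ 1
count-≟ {a} {n} a<n = begin
  count n (λ x → does (x ≟ a))
    ≡⟨ ∑-cong n (λ x _ → cong 𝟙 (does-⇔ (mk⇔ singleton (uncurry′ pinned)) (x ≟ a) (x ∈[ a , suc a ⟩?))) ⟩
  count n (λ x → does (x ∈[ a , suc a ⟩?))       ≡⟨ count-interval (n≤1+n a) a<n ⟩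
  suc a ∸ a                                      ≡⟨ m+n∸n≡m 1 a ⟩
  1                                              ∎
  where
  open ≡-Reasoning
  singleton : ∀ {x} → x ≡ a → a ≤ x × x < suc a
  singleton refl = ≤-refl , ≤-refl
  pinned : ∀ {x} → a ≤ x → x < suc a → x ≡ a
  pinned a≤x x<1+a = ≤-antisym (s≤s⁻¹ x<1+a) a≤x

count-≟-∧ : ∀ {a n} → a < n → ∀ e → count n (λ x → does (x ≟ a) ∧ e) ≡ 𝟙 e
count-≟-∧ {a} {n} a<n true  = trans (∑-cong n (λ x _ → cong 𝟙 (∧-identityʳ (does (x ≟ a))))) (count-≟ a<n)
count-≟-∧ {a} {n} a<n false = trans (∑-cong n (λ x _ → cong 𝟙 (∧-zeroʳ (does (x ≟ a))))) (trans (∑-const n 0) (*-zeroʳ n))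

𝟙-complement : ∀ X M a c → X + (𝟙 (not a) + 𝟙 (not c)) ≡ M + 2 → X ≡ M + 𝟙 a + 𝟙 c
𝟙-complement X M true  true  h = +-cancelʳ-≡ 0 X _ (trans h (shift M))
  where
  shift : ∀ M → M + 2 ≡ M + 1 + 1 + 0
  shift = solve-∀
𝟙-complement X M true  false h = +-cancelʳ-≡ 1 X _ (trans h (shift M))
  where
  shift : ∀ M → M + 2 ≡ M + 1 + 0 + 1
  shift = solve-∀
𝟙-complement X M false true  h = +-cancelʳ-≡ 1 X _ (trans h (shift M))
  where
  shift : ∀ M → M + 2 ≡ M + 0 + 1 + 1
  shift = solve-∀
𝟙-complement X M false false h = +-cancelʳ-≡ 2 X _ (trans h (shift M))
  where
  shift : ∀ M → M + 2 ≡ M + 0 + 0 + 2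
  shift = solve-∀

count-filter : ∀ {A : Set} n (g : Fin n → A) (P : A → Bool) (Q : ℕ → Bool) →
               (∀ i → P (g i) ≡ Q (toℕ i)) → length (filterᵇ P (tabulate g)) ≡ count n Q
count-filter zero    g P Q eq = refl
count-filter (suc n) g P Q eq with P (g Fin.zero) | eq Fin.zero
... | true  | e rewrite sym e = cong suc (count-filter n (g ∘ Fin.suc) P (Q ∘ suc) (eq ∘ Fin.suc))
... | false | e rewrite sym e = count-filter n (g ∘ Fin.suc) P (Q ∘ suc) (eq ∘ Fin.suc)

module _ {n} {G : Graph n} where

  Adj-sym : ∀ {u v} → Adj G u v → Adj G v u
  Adj-sym {u} {v} uv = trans (Graph.sym G v u) uv

  Reach-mono : ∀ {d d′ u v} → d ≤ d′ → Reach G d u v → Reach G d′ u v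
  Reach-mono _         here       = here
  Reach-mono (s≤s d≤d′) (step e r) = step e (Reach-mono d≤d′ r)

  Reach-++ : ∀ {a b u v w} → Reach G a u v → Reach G b v w → Reach G (a + b) u w
  Reach-++ {a} {b} here   r′ = Reach-mono (m≤n+m b a) r′
  Reach-++ (step e r)     r′ = step e (Reach-++ r r′)

  Reach-sym : ∀ {d u v} → Reach G d u v → Reach G d v u
  Reach-sym here                 = here
  Reach-sym {suc d} {u} {v} (step e r) =
    subst (λ k → Reach G k v u) (+-comm d 1) (Reach-++ (Reach-sym r) (step (Adj-sym e) here))

%-injective-on-window : ∀ k .{{_ : NonZero k}} {x y} → x < y → y < x + k → x % k ≢ y % k
%-injective-on-window k {x} {y} x<y y<x+k eq with y / k ≤? x / k
... | yes y/k≤x/k = <⇒≱ x<y (begin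
  y                   ≡⟨ m≡m%n+[m/n]*n y k ⟩
  y % k + y / k * k   ≤⟨ +-mono-≤ (≤-reflexive (sym eq)) (*-monoˡ-≤ k y/k≤x/k) ⟩
  x % k + x / k * k   ≡⟨ sym (m≡m%n+[m/n]*n x k) ⟩
  x                   ∎)
  where open ≤-Reasoning
... | no y/k≰x/k = <⇒≱ y<x+k (begin
  x + k                      ≡⟨ cong (_+ k) (m≡m%n+[m/n]*n x k) ⟩
  x % k + x / k * k + k      ≡⟨ +-assoc (x % k) _ k ⟩
  x % k + (x / k * k + k)    ≡⟨ cong (x % k +_) (+-comm (x / k * k) k) ⟩
  x % k + suc (x / k) * k    ≤⟨ +-mono-≤ (≤-reflexive eq) (*-monoˡ-≤ k (≰⇒> y/k≰x/k)) ⟩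
  y % k + y / k * k          ≡⟨ sym (m≡m%n+[m/n]*n y k) ⟩
  y                          ∎)
  where open ≤-Reasoning

-- Layered graphs

-- Layer ℓ < L consists of w ℓ classes, class c having z ℓ c vertices.  The vertices are
-- numbered layer by layer and, inside a layer, class by class.
module LayeredGraph (L : ℕ) (w : ℕ → ℕ) (z : ℕ → ℕ → ℕ) where

  layerSize : ℕ → ℕ
  layerSize ℓ = ∑ (w ℓ) (z ℓ)

  start : ℕ → ℕ
  start ℓ = ∑ ℓ layerSize

  classStart : ℕ → ℕ → ℕ
  classStart ℓ c = start ℓ + ∑ c (z ℓ)

  N : ℕ
  N = start L

  layerOf : ℕ → ℕ
  layerOf x = locate L layerSize x

  classOf : ℕ → ℕ
  classOf x = locate (w (layerOf x)) (z (layerOf x)) (x ∸ start (layerOf x))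

  record Position (x ℓ c : ℕ) : Set where
    field
      layer<L   : ℓ < L
      class<w   : c < w ℓ
      atLeast   : classStart ℓ c ≤ x
      below     : x < classStart ℓ (suc c)

  start-mono : ∀ {a b} → a ≤ b → start a ≤ start b
  start-mono = ∑-monoˡ-≤ layerSize

  start-suc : ∀ ℓ → start (suc ℓ) ≡ start ℓ + layerSize ℓ
  start-suc ℓ = ∑-suc ℓ layerSize

  classStart≤start : ∀ {ℓ c} → c ≤ w ℓ → classStart ℓ c ≤ start (suc ℓ)
  classStart≤start {ℓ} {c} c≤w = subst (classStart ℓ c ≤_) (sym (start-suc ℓ)) (+-monoʳ-≤ (start ℓ) (∑-monoˡ-≤ (z ℓ) c≤w))

  Position⇒layer : ∀ {x ℓ c} → Position x ℓ c → start ℓ ≤ x × x < start (suc ℓ)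
  Position⇒layer p = ≤-trans (m≤m+n _ _) atLeast , <-≤-trans below (classStart≤start class<w)
    where open Position p

  Position⇒<N : ∀ {x ℓ c} → Position x ℓ c → x < N
  Position⇒<N p = <-≤-trans (proj₂ (Position⇒layer p)) (start-mono (Position.layer<L p))

  layerOf-correct : ∀ {x} → x < N → Located L layerSize x (layerOf x)
  layerOf-correct {x} = locate-correct L layerSize x

  layerOf-unique : ∀ {x ℓ} → ℓ < L → start ℓ ≤ x → x < start (suc ℓ) → layerOf x ≡ ℓ
  layerOf-unique {x} {ℓ} ℓ<L lower upper = locate-unique L layerSize x ℓ (ℓ<L , lower , upper)

  position : ∀ {x} → x < N → Position x (layerOf x) (classOf x)
  position {x} x<N = record
    { layer<L = ℓ<L
    ; class<w = c<w
    ; atLeast = subst (classStart ℓ (classOf x) ≤_) start+offset≡x (+-monoʳ-≤ (start ℓ) lower)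
    ; below   = subst (_< classStart ℓ (suc (classOf x))) start+offset≡x (+-monoʳ-< (start ℓ) upper)
    }
    where
    ℓ : ℕ
    ℓ = layerOf x
    located : Located L layerSize x ℓ
    located = layerOf-correct x<N
    ℓ<L : ℓ < L
    ℓ<L = proj₁ located
    start+offset≡x : start ℓ + (x ∸ start ℓ) ≡ x
    start+offset≡x = m+[n∸m]≡n (proj₁ (proj₂ located))
    offset<size : x ∸ start ℓ < layerSize ℓ
    offset<size = +-cancelˡ-< (start ℓ) _ _
      (subst₂ _<_ (sym start+offset≡x) (start-suc ℓ) (proj₂ (proj₂ located)))
    classLocated : Located (w ℓ) (z ℓ) (x ∸ start ℓ) (classOf x)
    classLocated = locate-correct (w ℓ) (z ℓ) (x ∸ start ℓ) offset<size
    c<w : classOf x < w ℓ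
    c<w = proj₁ classLocated
    lower : ∑ (classOf x) (z ℓ) ≤ x ∸ start ℓ
    lower = proj₁ (proj₂ classLocated)
    upper : x ∸ start ℓ < ∑ (suc (classOf x)) (z ℓ)
    upper = proj₂ (proj₂ classLocated)

  position-unique : ∀ {x ℓ c} → Position x ℓ c → layerOf x ≡ ℓ × classOf x ≡ c
  position-unique {x} {ℓ} {c} p = layer≡ , trans (cong classIn layer≡) (locate-unique (w ℓ) (z ℓ) (x ∸ start ℓ) c
      (class<w , ∸-monoˡ-≤′ atLeast , ∸-monoˡ-<′ below))
    where
    open Position p
    classIn : ℕ → ℕ
    classIn ℓ′ = locate (w ℓ′) (z ℓ′) (x ∸ start ℓ′)
    layer≡ : layerOf x ≡ ℓ
    layer≡ = layerOf-unique layer<L (proj₁ (Position⇒layer p)) (proj₂ (Position⇒layer p))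
    ∸-monoˡ-≤′ : ∀ {a} → start ℓ + a ≤ x → a ≤ x ∸ start ℓ
    ∸-monoˡ-≤′ {a} le = subst (_≤ x ∸ start ℓ) (m+n∸m≡n (start ℓ) a) (∸-monoˡ-≤ (start ℓ) le)
    ∸-monoˡ-<′ : ∀ {a} → x < start ℓ + a → x ∸ start ℓ < a
    ∸-monoˡ-<′ {a} lt = subst (x ∸ start ℓ <_) (m+n∸m≡n (start ℓ) a)
      (∸-monoˡ-< lt (proj₁ (Position⇒layer p)))

  layerOf-interval : ∀ {y} → y < N → start (layerOf y) ≤ y × y < start (suc (layerOf y))
  layerOf-interval y<N = proj₂ (layerOf-correct y<N)

  start≤⇒≤layerOf : ∀ {a y} → y < N → start a ≤ y → a ≤ layerOf y
  start≤⇒≤layerOf y<N le = ≮⇒≥ λ ℓ<a →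
    <⇒≱ (proj₂ (layerOf-interval y<N)) (≤-trans (start-mono ℓ<a) le)

  <start⇒layerOf< : ∀ {b y} → y < N → y < start b → layerOf y < b
  <start⇒layerOf< y<N lt = ≰⇒> λ b≤ℓ →
    <⇒≱ lt (≤-trans (start-mono b≤ℓ) (proj₁ (layerOf-interval y<N)))

  Adjacent : ℕ → ℕ → Set
  Adjacent x y = (layerOf x ≡ layerOf y × classOf x ≢ classOf y)
               ⊎ (suc (layerOf x) ≡ layerOf y ⊎ suc (layerOf y) ≡ layerOf x)

  adjacent? : ∀ x y → Dec (Adjacent x y)
  adjacent? x y = ((layerOf x ≟ layerOf y) ×-dec ¬? (classOf x ≟ classOf y))
          ⊎-dec ((suc (layerOf x) ≟ layerOf y) ⊎-dec (suc (layerOf y) ≟ layerOf x))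

  Adjacent-sym : ∀ {x y} → Adjacent x y → Adjacent y x
  Adjacent-sym (inj₁ (same , differ)) = inj₁ (sym same , differ ∘ sym)
  Adjacent-sym (inj₂ (inj₁ up))       = inj₂ (inj₂ up)
  Adjacent-sym (inj₂ (inj₂ down))     = inj₂ (inj₁ down)

  Adjacent-irrefl : ∀ {x} → ¬ Adjacent x x
  Adjacent-irrefl (inj₁ (_ , differ)) = differ refl
  Adjacent-irrefl (inj₂ (inj₁ up))    = 1+n≢n up
  Adjacent-irrefl (inj₂ (inj₂ down))  = 1+n≢n down

  graph : Graph N
  graph = record
    { adj      = λ u v → does (adjacent? (toℕ u) (toℕ v))
    ; sym      = λ u v → does-⇔ (mk⇔ Adjacent-sym Adjacent-sym) (adjacent? _ _) (adjacent? _ _)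
    ; loopless = λ v → dec-false (adjacent? _ _) Adjacent-irrefl
    }

  Adj⇒Adjacent : ∀ {u v} → Adj graph u v → Adjacent (toℕ u) (toℕ v)
  Adj⇒Adjacent = does-true⇒ (adjacent? _ _)

  Adjacent⇒Adj : ∀ {u v} → Adjacent (toℕ u) (toℕ v) → Adj graph u v
  Adjacent⇒Adj = dec-true (adjacent? _ _)

  window : ℕ → ℕ
  window zero    = layerSize 0 + layerSize 1
  window (suc ℓ) = layerSize ℓ + layerSize (suc ℓ) + layerSize (2 + ℓ)

  start-window : ∀ ℓ → start (2 + ℓ) ≡ start (ℓ ∸ 1) + window ℓ
  start-window zero    = cong (layerSize 0 +_) (+-identityʳ (layerSize 1))
  start-window (suc ℓ) = begin
    start (3 + ℓ)                                                     ≡⟨ start-suc (2 + ℓ) ⟩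
    start (2 + ℓ) + layerSize (2 + ℓ)                                 ≡⟨ cong (_+ layerSize (2 + ℓ)) (start-suc (suc ℓ)) ⟩
    start (suc ℓ) + layerSize (suc ℓ) + layerSize (2 + ℓ)             ≡⟨ cong (λ t → t + layerSize (suc ℓ) + layerSize (2 + ℓ)) (start-suc ℓ) ⟩
    start ℓ + layerSize ℓ + layerSize (suc ℓ) + layerSize (2 + ℓ)     ≡⟨ cong (_+ layerSize (2 + ℓ)) (+-assoc (start ℓ) _ _) ⟩
    start ℓ + (layerSize ℓ + layerSize (suc ℓ)) + layerSize (2 + ℓ)   ≡⟨ +-assoc (start ℓ) _ _ ⟩
    start ℓ + window (suc ℓ)                                          ∎
    where open ≡-Reasoning

  classStart-suc : ∀ ℓ c → classStart ℓ (suc c) ≡ classStart ℓ c + z ℓ c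
  classStart-suc ℓ c = trans (cong (start ℓ +_) (∑-suc c (z ℓ))) (sym (+-assoc (start ℓ) _ _))

  module Neighbourhood {x} (x<N : x < N) where

    ℓ c : ℕ
    ℓ = layerOf x
    c = classOf x

    InWindow InClass : ℕ → Set
    InWindow y = start (ℓ ∸ 1) ≤ y × y < start (2 + ℓ)
    InClass  y = classStart ℓ c ≤ y × y < classStart ℓ (suc c)

    open Position (position x<N)

    start≤classStart : start ℓ ≤ classStart ℓ c
    start≤classStart = m≤m+n (start ℓ) _

    classEnd≤start : classStart ℓ (suc c) ≤ start (suc ℓ)
    classEnd≤start = classStart≤start class<w

    window-lower : start (ℓ ∸ 1) ≤ start ℓ
    window-lower = start-mono (m∸n≤m ℓ 1)

    window-upper : start (suc ℓ) ≤ start (2 + ℓ)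
    window-upper = start-mono (n≤1+n (suc ℓ))

    Adjacent⇒InWindow : ∀ {y} → y < N → Adjacent x y → InWindow y × ¬ InClass y
    Adjacent⇒InWindow {y} y<N (inj₁ (same , differ)) =
      ( ≤-trans window-lower (subst (λ k → start k ≤ y) (sym same) (proj₁ (layerOf-interval y<N)))
      , <-≤-trans (subst (λ k → y < start (suc k)) (sym same) (proj₂ (layerOf-interval y<N))) window-upper )
      , λ (lower , upper) → differ (sym (proj₂ (position-unique (record
          { layer<L = layer<L ; class<w = class<w ; atLeast = lower ; below = upper }))))
    Adjacent⇒InWindow {y} y<N (inj₂ (inj₁ up)) =
      ( ≤-trans window-lower (≤-trans (start-mono (n≤1+n ℓ)) start≤y)
      , subst (λ k → y < start (suc k)) (sym up) (proj₂ (layerOf-interval y<N)) )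
      , λ (_ , upper) → <⇒≱ upper (≤-trans classEnd≤start start≤y)
      where
      start≤y : start (suc ℓ) ≤ y
      start≤y = subst (λ k → start k ≤ y) (sym up) (proj₁ (layerOf-interval y<N))
    Adjacent⇒InWindow {y} y<N (inj₂ (inj₂ down)) =
      ( subst (λ k → start k ≤ y) (cong pred down) (proj₁ (layerOf-interval y<N))
      , <-≤-trans y<start (≤-trans (start-mono (n≤1+n ℓ)) window-upper) )
      , λ (lower , _) → <⇒≱ (<-≤-trans y<start start≤classStart) lower
      where
      y<start : y < start ℓ
      y<start = subst (λ k → y < start k) down (proj₂ (layerOf-interval y<N))

    InWindow⇒Adjacent : ∀ {y} → y < N → InWindow y → ¬ InClass y → Adjacent x y
    InWindow⇒Adjacent {y} y<N (lower , upper) outside with <-cmp (layerOf y) ℓ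
    ... | tri< below _ _ = inj₂ (inj₂ (≤-antisym below (≤-trans (m≤n+m∸n ℓ 1) (s≤s (start≤⇒≤layerOf y<N lower)))))
    ... | tri> _ _ above = inj₂ (inj₁ (≤-antisym above (s≤s⁻¹ (<start⇒layerOf< y<N upper))))
    ... | tri≈ _ same _  = inj₁ (sym same , λ c≡ → outside (subst₂ InClassOf same (sym c≡) (atLeast′ , below′)))
      where
      open Position (position y<N) renaming (atLeast to atLeast′; below to below′)
      InClassOf : ℕ → ℕ → Set
      InClassOf ℓ′ c′ = classStart ℓ′ c′ ≤ y × y < classStart ℓ′ (suc c′)

    adjacent⇔inWindow : ∀ {y} → y < N → Adjacent x y ⇔ (InWindow y × ¬ InClass y)
    adjacent⇔inWindow y<N = mk⇔ (Adjacent⇒InWindow y<N) (λ (inside , outside) → InWindow⇒Adjacent y<N inside outside)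

    window≤N : layerSize L ≡ 0 → start (2 + ℓ) ≤ N
    window≤N emptyAfter with 2 + ℓ ≤? L
    ... | yes 2+ℓ≤L = start-mono 2+ℓ≤L
    ... | no  2+ℓ≰L = ≤-reflexive (begin
      start (2 + ℓ)                      ≡⟨ start-suc (suc ℓ) ⟩
      start (suc ℓ) + layerSize (suc ℓ)  ≡⟨ cong (λ k → start k + layerSize k) last ⟩
      N + layerSize L                    ≡⟨ cong (N +_) emptyAfter ⟩
      N + 0                              ≡⟨ +-identityʳ N ⟩
      N                                  ∎)
      where
      open ≡-Reasoning
      last : suc ℓ ≡ L
      last = ≤-antisym layer<L (s≤s⁻¹ (≰⇒> 2+ℓ≰L))

    neighbourCount : layerSize L ≡ 0 → count N (λ y → does (adjacent? x y)) ≡ window ℓ ∸ z ℓ c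
    neighbourCount emptyAfter = begin
      count N (λ y → does (adjacent? x y))
        ≡⟨ ∑-cong N (λ y y<N → cong 𝟙 (does-⇔ (adjacent⇔inWindow y<N) (adjacent? x y) (inWindow? y ×-dec ¬? (inClass? y)))) ⟩
      count N (λ y → does (inWindow? y) ∧ not (does (inClass? y)))
        ≡⟨ count-∧-not N _ _ class⊆window ⟩
      count N (does ∘ inWindow?) ∸ count N (does ∘ inClass?)
        ≡⟨ cong₂ _∸_ (count-interval lo≤hi hi≤N) (count-interval clo≤chi chi≤N) ⟩
      (start (2 + ℓ) ∸ start (ℓ ∸ 1)) ∸ (classStart ℓ (suc c) ∸ classStart ℓ c)
        ≡⟨ cong₂ _∸_ (trans (cong (_∸ start (ℓ ∸ 1)) (start-window ℓ)) (m+n∸m≡n (start (ℓ ∸ 1)) (window ℓ)))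
                     (trans (cong (_∸ classStart ℓ c) (classStart-suc ℓ c)) (m+n∸m≡n (classStart ℓ c) (z ℓ c))) ⟩
      window ℓ ∸ z ℓ c
        ∎
      where
      open ≡-Reasoning
      inWindow? : ∀ y → Dec (InWindow y)
      inWindow? y = y ∈[ start (ℓ ∸ 1) , start (2 + ℓ) ⟩?
      inClass? : ∀ y → Dec (InClass y)
      inClass? y = y ∈[ classStart ℓ c , classStart ℓ (suc c) ⟩?
      lo≤hi : start (ℓ ∸ 1) ≤ start (2 + ℓ)
      lo≤hi = ≤-trans window-lower (≤-trans (start-mono (n≤1+n ℓ)) window-upper)
      hi≤N : start (2 + ℓ) ≤ N
      hi≤N = window≤N emptyAfter
      clo≤chi : classStart ℓ c ≤ classStart ℓ (suc c)
      clo≤chi = subst (classStart ℓ c ≤_) (sym (classStart-suc ℓ c)) (m≤m+n _ _)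
      chi≤N : classStart ℓ (suc c) ≤ N
      chi≤N = ≤-trans classEnd≤start (≤-trans window-upper hi≤N)
      class⊆window : ∀ y → y < N → does (inClass? y) ≡ true → does (inWindow? y) ≡ true
      class⊆window y _ inside with does-true⇒ (inClass? y) inside
      ... | lower , upper = dec-true (inWindow? y)
        ( ≤-trans window-lower (≤-trans start≤classStart lower)
        , <-≤-trans upper (≤-trans classEnd≤start window-upper) )

  degree≡ : layerSize L ≡ 0 → ∀ v → degree graph v ≡ window (layerOf (toℕ v)) ∸ z (layerOf (toℕ v)) (classOf (toℕ v))
  degree≡ emptyAfter v = trans (count-filter N (λ u → u) (adj graph v) (does ∘ adjacent? (toℕ v)) (λ _ → refl))
                               (Neighbourhood.neighbourCount (toℕ<n v) emptyAfter)

  minDegree : ∀ δ → layerSize L ≡ 0 →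
              (∀ ℓ c → ℓ < L → c < w ℓ → δ + z ℓ c ≤ window ℓ) →
              (∃ λ ℓ → ∃ λ c → ℓ < L × c < w ℓ × 0 < z ℓ c × window ℓ ≡ δ + z ℓ c) →
              MinDegree graph δ
  minDegree δ emptyAfter window≥ (ℓ , c , ℓ<L , c<w , 0<z , tight) = atLeastδ , vertex , exact
    where
    atLeastδ : ∀ v → δ ≤ degree graph v
    atLeastδ v = subst (δ ≤_) (sym (degree≡ emptyAfter v)) (m+n≤o⇒m≤o∸n δ (window≥ _ _ layer<L class<w))
      where open Position (position (toℕ<n v))
    firstOfClass : Position (classStart ℓ c) ℓ c
    firstOfClass = record
      { layer<L = ℓ<L ; class<w = c<w ; atLeast = ≤-refl
      ; below = subst (classStart ℓ c <_) (sym (classStart-suc ℓ c)) (m<m+n _ 0<z) }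
    vertex : Fin N
    vertex = fromℕ< (Position⇒<N firstOfClass)
    exact : degree graph vertex ≡ δ
    exact = begin
      degree graph vertex                                                   ≡⟨ degree≡ emptyAfter vertex ⟩
      window (layerOf (toℕ vertex)) ∸ z (layerOf (toℕ vertex)) (classOf (toℕ vertex))
        ≡⟨ cong (λ x → window (layerOf x) ∸ z (layerOf x) (classOf x)) (toℕ-fromℕ< _) ⟩
      window (layerOf (classStart ℓ c)) ∸ z (layerOf (classStart ℓ c)) (classOf (classStart ℓ c))
        ≡⟨ cong₂ (λ ℓ′ c′ → window ℓ′ ∸ z ℓ′ c′) (proj₁ (position-unique firstOfClass)) (proj₂ (position-unique firstOfClass)) ⟩
      window ℓ ∸ z ℓ c                                                      ≡⟨ cong (_∸ z ℓ c) tight ⟩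
      δ + z ℓ c ∸ z ℓ c                                                     ≡⟨ m+n∸n≡m δ (z ℓ c) ⟩
      δ                                                                     ∎
      where open ≡-Reasoning

  layer : Fin N → ℕ
  layer u = layerOf (toℕ u)

  layer<L : ∀ u → layer u < L
  layer<L u = proj₁ (layerOf-correct (toℕ<n u))

  Adj⇒layer≤ : ∀ {u v} → Adj graph u v → layer v ≤ suc (layer u)
  Adj⇒layer≤ uv with Adj⇒Adjacent uv
  ... | inj₁ (same , _)    = ≤-trans (≤-reflexive (sym same)) (n≤1+n _)
  ... | inj₂ (inj₁ up)     = ≤-reflexive (sym up)
  ... | inj₂ (inj₂ down)   = ≤-trans (n≤1+n _) (≤-trans (≤-reflexive down) (n≤1+n _))

  Reach⇒layer≤ : ∀ {d u v} → Reach graph d u v → layer v ≤ layer u + d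
  Reach⇒layer≤ {d} here = m≤m+n _ d
  Reach⇒layer≤ {suc d} {u} (step {w = w′} uw r) = begin
    layer _            ≤⟨ Reach⇒layer≤ r ⟩
    layer w′ + d       ≤⟨ +-monoˡ-≤ d (Adj⇒layer≤ uw) ⟩
    suc (layer u) + d  ≡⟨ sym (+-suc (layer u) d) ⟩
    layer u + suc d    ∎
    where open ≤-Reasoning

  step-up : ∀ {u v} → suc (layer u) ≡ layer v → Reach graph 1 u v
  step-up up = step (Adjacent⇒Adj (inj₂ (inj₁ up))) here

  module Distances (nonempty : ∀ ℓ → ℓ < L → 0 < layerSize ℓ) where

    firstOf : ∀ ℓ → ℓ < L → Fin N
    firstOf ℓ ℓ<L = fromℕ< (<-≤-trans start<next (start-mono ℓ<L))
      where
      start<next : start ℓ < start (suc ℓ)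
      start<next = subst (start ℓ <_) (sym (start-suc ℓ)) (m<m+n (start ℓ) (nonempty ℓ ℓ<L))

    layer-firstOf : ∀ ℓ ℓ<L → layer (firstOf ℓ ℓ<L) ≡ ℓ
    layer-firstOf ℓ ℓ<L = trans (cong layerOf (toℕ-fromℕ< _))
      (layerOf-unique ℓ<L ≤-refl (subst (start ℓ <_) (sym (start-suc ℓ)) (m<m+n (start ℓ) (nonempty ℓ ℓ<L))))

    ascend : ∀ d u v → suc (layer u) + d ≡ layer v → Reach graph (suc d) u v
    ascend zero    u v up = step-up (trans (sym (+-identityʳ _)) up)
    ascend (suc d) u v up = Reach-++ (step-up (sym (layer-firstOf _ next<L)))
      (ascend d (firstOf _ next<L) v (trans (cong (λ ℓ → suc ℓ + d) (layer-firstOf _ next<L)) shifted))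
      where
      shifted : suc (suc (layer u)) + d ≡ layer v
      shifted = trans (sym (+-suc (suc (layer u)) d)) up
      next<L : suc (layer u) < L
      next<L = ≤-trans (≤-trans (m≤m+n _ d) (≤-reflexive shifted)) (<⇒≤ (layer<L v))

    across : 3 ≤ L → ∀ u v → layer u ≡ layer v → Reach graph 2 u v
    across 3≤L u v same with suc (layer u) <? L
    ... | yes next<L = Reach-++ (step-up (sym (layer-firstOf _ next<L)))
                                (Reach-sym (step-up (trans (cong suc (sym same)) (sym (layer-firstOf _ next<L)))))
    ... | no  next≮L = Reach-++ (Reach-sym (step-up below)) (step-up (trans below same))
      where
      last : suc (layer u) ≡ L
      last = ≤-antisym (layer<L u) (≮⇒≥ next≮L)
      prev<L : pred (layer u) < L
      prev<L = ≤-<-trans (m∸n≤m _ 1) (layer<L u)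
      below : suc (layer (firstOf _ prev<L)) ≡ layer u
      below = trans (cong suc (layer-firstOf _ prev<L)) (suc-pred (layer u) {{>-nonZero 0<ℓ}})
        where
        0<ℓ : 0 < layer u
        0<ℓ = ≤-trans (s≤s z≤n) (s≤s⁻¹ (subst (3 ≤_) (sym last) 3≤L))

    gap≤ : ∀ {a b} → a < b → b < L → suc (b ∸ suc a) ≤ L ∸ 1
    gap≤ {a} {b} a<b b<L = ≤-trans (∸-monoʳ-< {b} {suc a} {0} z<s a<b) (<⇒≤pred b<L)

    reach : 3 ≤ L → ∀ u v → Reach graph (L ∸ 1) u v
    reach 3≤L u v with <-cmp (layer u) (layer v)
    ... | tri< lt _ _ = Reach-mono (gap≤ lt (layer<L v)) (ascend _ u v (m+[n∸m]≡n lt))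
    ... | tri≈ _ eq _ = Reach-mono (pred-mono-≤ 3≤L) (across 3≤L u v eq)
    ... | tri> _ _ gt = Reach-sym (Reach-mono (gap≤ gt (layer<L u)) (ascend _ v u (m+[n∸m]≡n gt)))

    diameter : 3 ≤ L → IsDiameter graph (L ∸ 1)
    diameter 3≤L = reach 3≤L , firstOf 0 0<L , firstOf (L ∸ 1) last<L , far
      where
      0<L : 0 < L
      0<L = ≤-trans (s≤s z≤n) 3≤L
      last<L : L ∸ 1 < L
      last<L = ∸-monoʳ-< {L} {1} {0} z<s 0<L
      far : ∀ d → d < L ∸ 1 → ¬ Reach graph d (firstOf 0 0<L) (firstOf (L ∸ 1) last<L)
      far d d<D r = <⇒≱ d<D (subst₂ _≤_ (layer-firstOf _ last<L) (cong (_+ d) (layer-firstOf 0 0<L)) (Reach⇒layer≤ r))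

  module Colouring (k : ℕ) .{{_ : NonZero k}} (fit : ∀ ℓ → w ℓ + w (suc ℓ) ≤ k) where

    globalClass : ℕ → ℕ
    globalClass x = ∑ (layerOf x) w + classOf x

    Close : ℕ → ℕ → Set
    Close a b = a < b × b < a + k

    class<w : ∀ {y} → y < N → classOf y < w (layerOf y)
    class<w y<N = Position.class<w (position y<N)

    sameLayer-close : ∀ {x y} → y < N → layerOf x ≡ layerOf y → classOf x < classOf y →
                      Close (globalClass x) (globalClass y)
    sameLayer-close {x} {y} y<N same cx<cy = lower , upper
      where
      open ≤-Reasoning
      ℓ : ℕ
      ℓ = layerOf x
      gy≡ : globalClass y ≡ ∑ ℓ w + classOf y
      gy≡ = cong (λ ℓ′ → ∑ ℓ′ w + classOf y) (sym same)
      lower : globalClass x < globalClass y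
      lower = subst (globalClass x <_) (sym gy≡) (+-monoʳ-< (∑ ℓ w) cx<cy)
      upper : globalClass y < globalClass x + k
      upper = subst (_< globalClass x + k) (sym gy≡) (begin-strict
        ∑ ℓ w + classOf y      <⟨ +-monoʳ-< (∑ ℓ w) (subst (λ ℓ′ → classOf y < w ℓ′) (sym same) (class<w y<N)) ⟩
        ∑ ℓ w + w ℓ            ≤⟨ +-monoʳ-≤ (∑ ℓ w) (≤-trans (m≤m+n (w ℓ) _) (fit ℓ)) ⟩
        ∑ ℓ w + k              ≤⟨ +-monoˡ-≤ k (m≤m+n (∑ ℓ w) (classOf x)) ⟩
        globalClass x + k      ∎)

    nextLayer-close : ∀ {x y} → x < N → y < N → suc (layerOf x) ≡ layerOf y →
                      Close (globalClass x) (globalClass y)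
    nextLayer-close {x} {y} x<N y<N up = lower , upper
      where
      open ≤-Reasoning
      ℓ : ℕ
      ℓ = layerOf x
      gy≡ : globalClass y ≡ ∑ ℓ w + (w ℓ + classOf y)
      gy≡ = trans (cong (_+ classOf y) (trans (cong (λ ℓ′ → ∑ ℓ′ w) (sym up)) (∑-suc ℓ w))) (+-assoc (∑ ℓ w) _ _)
      lower : globalClass x < globalClass y
      lower = subst (globalClass x <_) (sym gy≡) (begin-strict
        ∑ ℓ w + classOf x               <⟨ +-monoʳ-< (∑ ℓ w) (class<w x<N) ⟩
        ∑ ℓ w + w ℓ                     ≤⟨ +-monoʳ-≤ (∑ ℓ w) (m≤m+n (w ℓ) (classOf y)) ⟩
        ∑ ℓ w + (w ℓ + classOf y)       ∎)
      upper : globalClass y < globalClass x + k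
      upper = subst (_< globalClass x + k) (sym gy≡) (begin-strict
        ∑ ℓ w + (w ℓ + classOf y)       <⟨ +-monoʳ-< (∑ ℓ w) (+-monoʳ-< (w ℓ) (subst (λ ℓ′ → classOf y < w ℓ′) (sym up) (class<w y<N))) ⟩
        ∑ ℓ w + (w ℓ + w (suc ℓ))       ≤⟨ +-monoʳ-≤ (∑ ℓ w) (fit ℓ) ⟩
        ∑ ℓ w + k                       ≤⟨ +-monoˡ-≤ k (m≤m+n (∑ ℓ w) (classOf x)) ⟩
        globalClass x + k               ∎)

    colour : Fin N → Fin k
    colour u = globalClass (toℕ u) mod k

    colour-distinct : ∀ {u v} → Close (globalClass (toℕ u)) (globalClass (toℕ v)) → colour u ≢ colour v
    colour-distinct (lower , upper) same =
      %-injective-on-window k lower upper (trans (sym (toℕ-fromℕ< _)) (trans (cong toℕ same) (toℕ-fromℕ< _)))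

    colourable : Colorable graph k
    colourable = colour , proper
      where
      proper : ∀ u v → Adj graph u v → colour u ≢ colour v
      proper u v uv with Adj⇒Adjacent uv
      ... | inj₂ (inj₁ up)   = colour-distinct {u} {v} (nextLayer-close (toℕ<n u) (toℕ<n v) up)
      ... | inj₂ (inj₂ down) = colour-distinct {v} {u} (nextLayer-close (toℕ<n v) (toℕ<n u) down) ∘ sym
      ... | inj₁ (same , differ) with <-cmp (classOf (toℕ u)) (classOf (toℕ v))
      ...   | tri< lt _ _ = colour-distinct {u} {v} (sameLayer-close (toℕ<n v) same lt)
      ...   | tri≈ _ eq _ = ⊥-elim (differ eq)
      ...   | tri> _ _ gt = colour-distinct {v} {u} (sameLayer-close (toℕ<n u) (sym same) gt) ∘ sym

-- The blocks of G_{r,δ,p}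

data Kind : Set where
  single tail head : Kind

data Slot : Set where
  slot : (b j : ℕ) → Kind → Slot

rank : Kind → ℕ
rank single = 0
rank tail   = 1
rank head   = 2

-- Block b is the sequence of layers S₀ T₀ H₀ S₁ T₁ H₁ … S_K T_K H_K S_{K+1}, where slot b j single
-- is the one-vertex layer S_j, slot b j tail is T_j and slot b j head is H_j.
module Slots (K : ℕ) where

  blockLength : ℕ
  blockLength = suc (suc K * 3)

  afterSingle : ∀ b j → Dec (j ≡ suc K) → Slot
  afterSingle b j (yes _) = slot (suc b) 0 single
  afterSingle b j (no _)  = slot b j tail

  next : Slot → Slot
  next (slot b j single) = afterSingle b j (j ≟ suc K)
  next (slot b j tail)   = slot b j head
  next (slot b j head)   = slot b (suc j) single

  slotAt : ℕ → Slot
  slotAt = fold (slot 0 0 single) next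

  Valid : Slot → Set
  Valid (slot _ j single) = j ≤ suc K
  Valid (slot _ j tail)   = j ≤ K
  Valid (slot _ j head)   = j ≤ K

  block : Slot → ℕ
  block (slot b _ _) = b

  index : Slot → ℕ
  index (slot b j κ) = b * blockLength + (j * 3 + rank κ)

  next-valid : ∀ x → Valid x → Valid (next x)
  next-valid (slot b j single) j≤ with j ≟ suc K
  ... | yes _ = z≤n
  ... | no j≢ = s≤s⁻¹ (≤∧≢⇒< j≤ j≢)
  next-valid (slot b j tail) j≤ = j≤
  next-valid (slot b j head) j≤ = s≤s j≤

  next-index : ∀ x → Valid x → index (next x) ≡ suc (index x)
  next-index (slot b j single) _ with j ≟ suc K
  ... | yes refl = wrap b K
    where
    wrap : ∀ b K → suc b * suc (suc K * 3) + (0 * 3 + 0) ≡ suc (b * suc (suc K * 3) + (suc K * 3 + 0))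
    wrap = solve-∀
  ... | no _ = shift (b * blockLength) (j * 3)
    where
    shift : ∀ a c → a + (c + 1) ≡ suc (a + (c + 0))
    shift = solve-∀
  next-index (slot b j tail) _ = shift (b * blockLength) (j * 3)
    where
    shift : ∀ a c → a + (c + 2) ≡ suc (a + (c + 1))
    shift = solve-∀
  next-index (slot b j head) _ = shift (b * blockLength) (j * 3)
    where
    shift : ∀ a c → a + (3 + c + 0) ≡ suc (a + (c + 2))
    shift = solve-∀

  slotAt-valid : ∀ ℓ → Valid (slotAt ℓ)
  slotAt-valid zero    = z≤n
  slotAt-valid (suc ℓ) = next-valid (slotAt ℓ) (slotAt-valid ℓ)

  index-slotAt : ∀ ℓ → index (slotAt ℓ) ≡ ℓ
  index-slotAt zero    = refl
  index-slotAt (suc ℓ) = trans (next-index (slotAt ℓ) (slotAt-valid ℓ)) (cong suc (index-slotAt ℓ))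

  block≤ : ∀ ℓ → block (slotAt ℓ) * blockLength ≤ ℓ
  block≤ ℓ with slotAt ℓ | index-slotAt ℓ
  ... | slot b j κ | refl = m≤m+n (b * blockLength) _

  next-single : ∀ b j → j ≤ K → next (slot b j single) ≡ slot b j tail
  next-single b j j≤K with j ≟ suc K
  ... | yes j≡ = ⊥-elim (<-irrefl j≡ (s≤s j≤K))
  ... | no _   = refl

  fold-next-triples : ∀ b j t → j + t ≤ suc K → fold (slot b j single) next (t * 3) ≡ slot b (j + t) single
  fold-next-triples b j zero    _ = cong (λ i → slot b i single) (sym (+-identityʳ j))
  fold-next-triples b j (suc t) j+t≤ = begin
    fold (slot b j single) next (3 + t * 3)               ≡⟨ fold-+ (slot b j single) next 3 {t * 3} ⟩
    fold (fold (slot b j single) next (t * 3)) next 3     ≡⟨ cong (λ x → fold x next 3) (fold-next-triples b j t (≤-trans (m≤n+m _ 1) 1+j+t≤)) ⟩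
    fold (slot b (j + t) single) next 3                   ≡⟨ cong (next ∘ next) (next-single b (j + t) (s≤s⁻¹ 1+j+t≤)) ⟩
    slot b (suc (j + t)) single                           ≡⟨ cong (λ i → slot b i single) (sym (+-suc j t)) ⟩
    slot b (j + suc t) single                             ∎
    where
    open ≡-Reasoning
    1+j+t≤ : suc (j + t) ≤ suc K
    1+j+t≤ = subst (_≤ suc K) (+-suc j t) j+t≤

  blockStart : ∀ b → slotAt (b * blockLength) ≡ slot b 0 single
  blockStart zero    = refl
  blockStart (suc b) = begin
    slotAt (blockLength + b * blockLength)                  ≡⟨ fold-+ (slot 0 0 single) next blockLength {b * blockLength} ⟩
    fold (slotAt (b * blockLength)) next blockLength        ≡⟨ cong (λ x → fold x next blockLength) (blockStart b) ⟩
    next (fold (slot b 0 single) next (suc K * 3))          ≡⟨ cong next (fold-next-triples b 0 (suc K) ≤-refl) ⟩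
    next (slot b (suc K) single)                            ≡⟨ wrap (suc K ≟ suc K) ⟩
    slot (suc b) 0 single                                   ∎
    where
    open ≡-Reasoning
    wrap : (d : Dec (suc K ≡ suc K)) → afterSingle b (suc K) d ≡ slot (suc b) 0 single
    wrap (yes _)  = refl
    wrap (no ≢K) = ⊥-elim (≢K refl)

  slotAt-inBlock : ∀ b o → slotAt (b * blockLength + o) ≡ fold (slot b 0 single) next o
  slotAt-inBlock b o = begin
    slotAt (b * blockLength + o)                 ≡⟨ cong slotAt (+-comm (b * blockLength) o) ⟩
    slotAt (o + b * blockLength)                 ≡⟨ fold-+ (slot 0 0 single) next o {b * blockLength} ⟩
    fold (slotAt (b * blockLength)) next o       ≡⟨ cong (λ x → fold x next o) (blockStart b) ⟩
    fold (slot b 0 single) next o                ∎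
    where open ≡-Reasoning

module Construction (K p δ : ℕ) (part : ℕ → ℕ)
  (0<K : 0 < K) (0<p : 0 < p)
  (∑part≡δ : ∑ (suc K) part ≡ δ)
  (part-positive : ∀ c → c ≤ K → 0 < part c)
  (part≤last : ∀ c → c ≤ K → part c ≤ part K)
  (last≤1+part : ∀ c → c ≤ K → part K ≤ suc (part c))
  (part≤first : ∀ c → c < K → part c ≤ part 0)
  where

  open Slots K

  -- T₀ loses a vertex in every block but the first, and H_K in every block but the last: this
  -- brings the order down to p · ((K + 2) δ + K) + 2 and leaves every window large enough.
  shrinkTail shrinkHead : ℕ → ℕ → Bool
  shrinkTail b j = does (j ≟ 0) ∧ not (does (b ≟ 0))
  shrinkHead b j = does (j ≟ K) ∧ not (does (suc b ≟ p))

  kindWidth : ℕ → Kind → ℕ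
  kindWidth j single = 1
  kindWidth j tail   = suc (K ∸ j)
  kindWidth j head   = suc j

  width : Slot → ℕ
  width (slot b j κ) = if does (b <? p) then kindWidth j κ else 0

  classSize : Slot → ℕ → ℕ
  classSize (slot b j single) c = 1
  classSize (slot b j tail)   c = part (j + c) ∸ 𝟙 (shrinkTail b j ∧ does (c ≟ K ∸ j))
  classSize (slot b j head)   c = part c ∸ 𝟙 (shrinkHead b j ∧ does (c ≟ j))

  size : Slot → ℕ
  size x = ∑ (width x) (classSize x)

  tailSize headSize : ℕ → ℕ → ℕ
  tailSize b j = ∑ (suc (K ∸ j)) (classSize (slot b j tail))
  headSize b j = ∑ (suc j) (classSize (slot b j head))

  width-inside : ∀ {b} j κ → b < p → width (slot b j κ) ≡ kindWidth j κ
  width-inside j κ b<p = cong (λ t → if t then kindWidth j κ else 0) (dec-true (_ <? p) b<p)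

  width≤ : ∀ b j κ → width (slot b j κ) ≤ kindWidth j κ
  width≤ b j κ = if≤ (does (b <? p))
    where
    if≤ : ∀ t → (if t then kindWidth j κ else 0) ≤ kindWidth j κ
    if≤ true  = ≤-refl
    if≤ false = z≤n

  size-inside : ∀ {b} j κ → b < p → size (slot b j κ) ≡ ∑ (kindWidth j κ) (classSize (slot b j κ))
  size-inside {b} j κ b<p = cong (λ n → ∑ n (classSize (slot b j κ))) (width-inside j κ b<p)

  partsFrom : ℕ → ℕ
  partsFrom j = ∑ (suc (K ∸ j)) (λ c → part (j + c))

  parts-split : ∀ j → j ≤ K → ∑ j part + partsFrom j ≡ δ
  parts-split j j≤K = begin
    ∑ j part + partsFrom j       ≡⟨ sym (∑-+ j (suc (K ∸ j)) part) ⟩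
    ∑ (j + suc (K ∸ j)) part     ≡⟨ cong (λ n → ∑ n part) (trans (+-suc j (K ∸ j)) (cong suc (m+[n∸m]≡n j≤K))) ⟩
    ∑ (suc K) part               ≡⟨ ∑part≡δ ⟩
    δ                            ∎
    where open ≡-Reasoning

  tail-restored : ∀ b j → j ≤ K → tailSize b j + 𝟙 (shrinkTail b j) ≡ partsFrom j
  tail-restored b j j≤K = ∑-shrinkLast (K ∸ j) (λ c → part (j + c)) (shrinkTail b j)
    (subst (λ c → 0 < part c) (sym (m+[n∸m]≡n j≤K)) (part-positive K ≤-refl))

  head-restored : ∀ b j → j ≤ K → headSize b j + 𝟙 (shrinkHead b j) ≡ ∑ (suc j) part
  head-restored b j j≤K = ∑-shrinkLast j part (shrinkHead b j) (part-positive j j≤K)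

  pair-restored : ∀ b j → j ≤ K →
    (tailSize b j + 𝟙 (shrinkTail b j)) + (headSize b j + 𝟙 (shrinkHead b j)) ≡ δ + part j
  pair-restored b j j≤K = begin
    (tailSize b j + 𝟙 (shrinkTail b j)) + (headSize b j + 𝟙 (shrinkHead b j))
      ≡⟨ cong₂ _+_ (tail-restored b j j≤K) (trans (head-restored b j j≤K) (∑-suc j part)) ⟩
    partsFrom j + (∑ j part + part j)        ≡⟨ sym (+-assoc (partsFrom j) _ _) ⟩
    partsFrom j + ∑ j part + part j          ≡⟨ cong (_+ part j) (trans (+-comm (partsFrom j) _) (parts-split j j≤K)) ⟩
    δ + part j                               ∎
    where open ≡-Reasoning

  shrinkTail⇒ : ∀ {b j} → shrinkTail b j ≡ true → j ≡ 0
  shrinkTail⇒ {b} {j} e = does-true⇒ (j ≟ 0) (∧-conicalˡ _ _ e)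

  shrinkHead⇒ : ∀ {b j} → shrinkHead b j ≡ true → j ≡ K
  shrinkHead⇒ {b} {j} e = does-true⇒ (j ≟ K) (∧-conicalˡ _ _ e)

  shrinks : ℕ → ℕ → ℕ
  shrinks b j = 𝟙 (shrinkTail b j) + 𝟙 (shrinkHead b j)

  pairClass≤ : ∀ b j zc → j ≤ K → zc ≤ part K → (shrinkTail b j ≡ true → zc ≤ part 0) →
               zc + shrinks b j ≤ suc (part j)
  pairClass≤ b j zc j≤K ≤last ≤first with shrinkTail b j in eT | shrinkHead b j in eH
  ... | true  | true  = ⊥-elim (<⇒≢ 0<K (trans (sym (shrinkTail⇒ {b} {j} eT)) (shrinkHead⇒ {b} {j} eH)))
  ... | true  | false = subst (_≤ suc (part j)) (+-comm 1 zc) (s≤s (subst (λ i → zc ≤ part i) (sym (shrinkTail⇒ {b} {j} eT)) (≤first refl)))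
  ... | false | true  = subst (_≤ suc (part j)) (+-comm 1 zc) (s≤s (subst (λ i → zc ≤ part i) (sym (shrinkHead⇒ {b} {j} eH)) ≤last))
  ... | false | false = subst (_≤ suc (part j)) (sym (+-identityʳ zc)) (≤-trans ≤last (last≤1+part j j≤K))

  pairWindow≥ : ∀ b j zc → j ≤ K → zc + shrinks b j ≤ suc (part j) → δ + zc ≤ suc (tailSize b j + headSize b j)
  pairWindow≥ b j zc j≤K bound = +-cancelʳ-≤ (shrinks b j) (δ + zc) _ (begin
    δ + zc + shrinks b j                         ≡⟨ +-assoc δ zc _ ⟩
    δ + (zc + shrinks b j)                       ≤⟨ +-monoʳ-≤ δ bound ⟩
    δ + suc (part j)                             ≡⟨ +-suc δ (part j) ⟩
    suc (δ + part j)                             ≡⟨ cong suc (sym (pair-restored b j j≤K)) ⟩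
    suc ((t + 𝟙 (shrinkTail b j)) + (h + 𝟙 (shrinkHead b j)))
                                                 ≡⟨ cong suc (interchange t _ h _) ⟩
    suc (t + h) + shrinks b j                    ∎)
    where
    open ≤-Reasoning
    t h : ℕ
    t = tailSize b j
    h = headSize b j

  tailClass≤part : ∀ b j c → classSize (slot b j tail) c ≤ part (j + c)
  tailClass≤part b j c = m∸n≤m (part (j + c)) (𝟙 (shrinkTail b j ∧ does (c ≟ K ∸ j)))

  headClass≤part : ∀ b j c → classSize (slot b j head) c ≤ part c
  headClass≤part b j c = m∸n≤m (part c) (𝟙 (shrinkHead b j ∧ does (c ≟ j)))

  tailClass≤last : ∀ b j c → j ≤ K → c < suc (K ∸ j) → classSize (slot b j tail) c ≤ part K
  tailClass≤last b j c j≤K c< = ≤-trans (tailClass≤part b j c) (part≤last (j + c) j+c≤K)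
    where
    j+c≤K : j + c ≤ K
    j+c≤K = subst (j + c ≤_) (m+[n∸m]≡n j≤K) (+-monoʳ-≤ j (s≤s⁻¹ c<))

  tailClass≤first : ∀ b j c → c < suc (K ∸ j) → shrinkTail b j ≡ true → classSize (slot b j tail) c ≤ part 0
  tailClass≤first b j c c< e with shrinkTail⇒ {b} {j} e
  ... | refl with c ≟ K
  ...   | yes refl = subst (λ t → part K ∸ 𝟙 t ≤ part 0) (sym (cong₂ _∧_ e (dec-true (K ≟ K) refl)))
                         (∸-monoˡ-≤ 1 (last≤1+part 0 z≤n))
  ...   | no c≢K   = ≤-trans (tailClass≤part b 0 c) (part≤first c (≤∧≢⇒< (s≤s⁻¹ c<) c≢K))

  headClass≤last : ∀ b j c → j ≤ K → c < suc j → classSize (slot b j head) c ≤ part K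
  headClass≤last b j c j≤K c< = ≤-trans (headClass≤part b j c) (part≤last c (≤-trans (s≤s⁻¹ c<) j≤K))

  headClass≤first : ∀ b j c → c < suc j → shrinkTail b j ≡ true → classSize (slot b j head) c ≤ part 0
  headClass≤first b j c c< e with shrinkTail⇒ {b} {j} e | c<
  ... | refl | s≤s z≤n = headClass≤part b 0 0

  slotWindow : Slot → ℕ
  slotWindow y = size y + size (next y) + size (next (next y))

  single-size : ∀ {b} j → b < p → size (slot b j single) ≡ 1
  single-size j b<p = size-inside j single b<p

  tailWindow : ∀ {b} j → b < p →
    size (slot b j single) + size (slot b j tail) + size (slot b j head) ≡ suc (tailSize b j + headSize b j)
  tailWindow j b<p = cong₂ _+_ (cong₂ _+_ (single-size j b<p) (size-inside j tail b<p)) (size-inside j head b<p)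

  headWindow≥ : ∀ {b} j → b < p →
    size (slot b j tail) + size (slot b j head) + size (slot b (suc j) single) ≡ suc (tailSize b j + headSize b j)
  headWindow≥ j b<p = trans (cong₂ _+_ (cong₂ _+_ (size-inside j tail b<p) (size-inside j head b<p)) (single-size (suc j) b<p))
                            (+-comm _ 1)

  firstWindow : size (slot 0 0 single) + size (slot 0 0 tail) ≡ δ + 1
  firstWindow = begin
    size (slot 0 0 single) + size (slot 0 0 tail)   ≡⟨ cong₂ _+_ (single-size 0 0<p) (size-inside 0 tail 0<p) ⟩
    1 + tailSize 0 0                                ≡⟨ +-comm 1 _ ⟩
    tailSize 0 0 + 1                                ≡⟨ cong (_+ 1) (trans (sym (+-identityʳ _)) (trans (tail-restored 0 0 z≤n) ∑part≡δ)) ⟩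
    δ + 1                                           ∎
    where open ≡-Reasoning

  wrapWindow : ∀ b j → suc b < p →
    size (slot b j single) + size (slot (suc b) 0 single) + size (slot (suc b) 0 tail) ≡ δ + 1
  wrapWindow b j b+1<p = begin
    size (slot b j single) + size (slot (suc b) 0 single) + size (slot (suc b) 0 tail)
      ≡⟨ cong₂ _+_ (cong₂ _+_ (single-size j (<-trans (n<1+n b) b+1<p)) (single-size 0 b+1<p)) (size-inside 0 tail b+1<p) ⟩
    1 + 1 + tailSize (suc b) 0                ≡⟨ trans (+-comm 2 _) (sym (+-assoc _ 1 1)) ⟩
    tailSize (suc b) 0 + 1 + 1                ≡⟨ cong (_+ 1) (trans (tail-restored (suc b) 0 z≤n) ∑part≡δ) ⟩
    δ + 1                                     ∎
    where open ≡-Reasoning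

  headWindow : ∀ b j → b < p → j < K →
    size (slot b j head) + size (slot b (suc j) single) + size (slot b (suc j) tail) ≡ δ + 1
  headWindow b j b<p j<K = begin
    size (slot b j head) + size (slot b (suc j) single) + size (slot b (suc j) tail)
      ≡⟨ cong₂ _+_ (cong₂ _+_ (size-inside j head b<p) (single-size (suc j) b<p)) (size-inside (suc j) tail b<p) ⟩
    headSize b j + 1 + tailSize b (suc j)     ≡⟨ rearrange (headSize b j) (tailSize b (suc j)) ⟩
    (headSize b j + 0) + (tailSize b (suc j) + 0) + 1
      ≡⟨ cong₂ (λ h t → h + t + 1) headFull (tail-restored b (suc j) j<K) ⟩
    ∑ (suc j) part + partsFrom (suc j) + 1    ≡⟨ cong (_+ 1) (parts-split (suc j) j<K) ⟩
    δ + 1                                     ∎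
    where
    open ≡-Reasoning
    rearrange : ∀ h t → h + 1 + t ≡ (h + 0) + (t + 0) + 1
    rearrange = solve-∀
    headFull : headSize b j + 0 ≡ ∑ (suc j) part
    headFull = trans (cong (λ t → headSize b j + 𝟙 (t ∧ not (does (suc b ≟ p)))) (sym (dec-false (j ≟ K) (<⇒≢ j<K))))
                     (head-restored b j (<⇒≤ j<K))

  lastHeadWindow : ∀ b → b < p →
    size (slot b K head) + size (slot b (suc K) single) + size (slot (suc b) 0 single) ≡ δ + 1
  lastHeadWindow b b<p = begin
    size (slot b K head) + size (slot b (suc K) single) + size (slot (suc b) 0 single)
      ≡⟨ cong₂ _+_ (cong₂ _+_ (size-inside K head b<p) (single-size (suc K) b<p)) nextBlock ⟩
    headSize b K + 1 + 𝟙 (shrinkHead b K)     ≡⟨ +-comm-last (headSize b K) 1 _ ⟩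
    headSize b K + 𝟙 (shrinkHead b K) + 1     ≡⟨ cong (_+ 1) (trans (head-restored b K ≤-refl) ∑part≡δ) ⟩
    δ + 1                                     ∎
    where
    open ≡-Reasoning
    +-comm-last : ∀ a m n → a + m + n ≡ a + n + m
    +-comm-last = solve-∀
    nextBlock : size (slot (suc b) 0 single) ≡ 𝟙 (shrinkHead b K)
    nextBlock = begin
      size (slot (suc b) 0 single)               ≡⟨ oneIf (does (suc b <? p)) ⟩
      𝟙 (does (suc b <? p))                      ≡⟨ cong 𝟙 (does-⇔ (mk⇔ <⇒≢ (≤∧≢⇒< b<p)) (suc b <? p) (¬? (suc b ≟ p))) ⟩
      𝟙 (not (does (suc b ≟ p)))                 ≡⟨ cong (λ t → 𝟙 (t ∧ not (does (suc b ≟ p)))) (sym (dec-true (K ≟ K) refl)) ⟩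
      𝟙 (shrinkHead b K)                         ∎
      where
      oneIf : ∀ t → ∑ (if t then 1 else 0) (λ _ → 1) ≡ 𝟙 t
      oneIf true  = refl
      oneIf false = refl

  slotWindow≥ : ∀ y → Valid y → block (next y) < p → ∀ c → c < width (next y) →
                δ + classSize (next y) c ≤ slotWindow y
  slotWindow≥ (slot b j single) j≤ b′<p c c< with j ≟ suc K
  ... | yes refl = ≤-reflexive (sym (wrapWindow b (suc K) b′<p))
  ... | no j≢    = subst (δ + classSize (slot b j tail) c ≤_) (sym (tailWindow j b′<p))
      (pairWindow≥ b j _ j≤K (pairClass≤ b j _ j≤K (tailClass≤last b j c j≤K c<′) (tailClass≤first b j c c<′)))
    where
    j≤K : j ≤ K
    j≤K = s≤s⁻¹ (≤∧≢⇒< j≤ j≢)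
    c<′ : c < suc (K ∸ j)
    c<′ = subst (c <_) (width-inside j tail b′<p) c<
  slotWindow≥ (slot b j tail) j≤K b<p c c< =
    subst (δ + classSize (slot b j head) c ≤_) (sym (headWindow≥ j b<p))
      (pairWindow≥ b j _ j≤K (pairClass≤ b j _ j≤K (headClass≤last b j c j≤K c<′) (headClass≤first b j c c<′)))
    where
    c<′ : c < suc j
    c<′ = subst (c <_) (width-inside j head b<p) c<
  slotWindow≥ (slot b j head) j≤K b<p c c< with suc j ≟ suc K
  ... | yes refl  = ≤-reflexive (sym (lastHeadWindow b b<p))
  ... | no 1+j≢   = ≤-reflexive (sym (headWindow b j b<p (≤∧≢⇒< j≤K (1+j≢ ∘ cong suc))))

  L : ℕ
  L = p * blockLength

  w : ℕ → ℕ
  w ℓ = width (slotAt ℓ)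

  z : ℕ → ℕ → ℕ
  z ℓ = classSize (slotAt ℓ)

  open LayeredGraph L w z public

  block<p : ∀ ℓ → ℓ < L → block (slotAt ℓ) < p
  block<p ℓ ℓ<L = ≰⇒> λ p≤b → <⇒≱ ℓ<L (≤-trans (*-monoˡ-≤ blockLength p≤b) (block≤ ℓ))

  emptyAfter : layerSize L ≡ 0
  emptyAfter = trans (cong (λ x → ∑ (width x) (classSize x)) (blockStart p))
    (cong (λ t → ∑ (if t then 1 else 0) (classSize (slot p 0 single))) (dec-false (p <? p) (<-irrefl refl)))

  window≥ : ∀ ℓ c → ℓ < L → c < w ℓ → δ + z ℓ c ≤ window ℓ
  window≥ zero    c _   _   = ≤-reflexive (sym firstWindow)
  window≥ (suc ℓ) c ℓ<L c<w = slotWindow≥ (slotAt ℓ) (slotAt-valid ℓ) (block<p (suc ℓ) ℓ<L) c c<w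

  3<L : 3 < L
  3<L = ≤-trans (s≤s (s≤s (s≤s (s≤s z≤n)))) (m≤n*m blockLength p {{>-nonZero 0<p}})

  tight : ∃ λ ℓ → ∃ λ c → ℓ < L × c < w ℓ × 0 < z ℓ c × window ℓ ≡ δ + z ℓ c
  tight = 3 , 0 , 3<L , subst (0 <_) (sym (width-inside 1 single 0<p)) z<s , z<s , windowAtS₁
    where
    windowAtS₁ : window 3 ≡ δ + 1
    windowAtS₁ = trans (cong (λ x → size (slot 0 0 head) + size (slot 0 1 single) + size x) (next-single 0 1 0<K))
                       (headWindow 0 0 0<p 0<K)

  shrinkFree : ∀ s d → (s ≡ true → d ≡ false) → 𝟙 (s ∧ d) ≡ 0
  shrinkFree true  false _ = refl
  shrinkFree true  true  h with h refl
  ... | ()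
  shrinkFree false d     _ = refl

  firstClass-positive : ∀ y → Valid y → 0 < classSize y 0
  firstClass-positive (slot b j single) _   = z<s
  firstClass-positive (slot b j tail)   j≤K =
    subst (0 <_) (sym (cong (part (j + 0) ∸_) unshrunk)) (part-positive (j + 0) (subst (_≤ K) (sym (+-identityʳ j)) j≤K))
    where
    unshrunk : 𝟙 (shrinkTail b j ∧ does (0 ≟ K ∸ j)) ≡ 0
    unshrunk = shrinkFree (shrinkTail b j) _ λ e → dec-false (0 ≟ K ∸ j) λ 0≡ → <⇒≢ 0<K (trans 0≡ (cong (K ∸_) (shrinkTail⇒ {b} {j} e)))
  firstClass-positive (slot b j head)   _   = subst (0 <_) (sym (cong (part 0 ∸_) unshrunk)) (part-positive 0 z≤n)
    where
    unshrunk : 𝟙 (shrinkHead b j ∧ does (0 ≟ j)) ≡ 0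
    unshrunk = shrinkFree (shrinkHead b j) _ λ e → dec-false (0 ≟ j) λ 0≡ → <⇒≢ 0<K (trans 0≡ (shrinkHead⇒ {b} {j} e))

  kindWidth-positive : ∀ j κ → 0 < kindWidth j κ
  kindWidth-positive j single = z<s
  kindWidth-positive j tail   = z<s
  kindWidth-positive j head   = z<s

  nonempty : ∀ ℓ → ℓ < L → 0 < layerSize ℓ
  nonempty ℓ ℓ<L with slotAt ℓ | slotAt-valid ℓ | block<p ℓ ℓ<L
  ... | slot b j κ | valid | b<p = <-≤-trans (firstClass-positive (slot b j κ) valid)
        (term≤∑ _ (classSize (slot b j κ)) (subst (0 <_) (sym (width-inside j κ b<p)) (kindWidth-positive j κ)))

  fit : ∀ ℓ → w ℓ + w (suc ℓ) ≤ suc (suc K)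
  fit ℓ = fitSlot (slotAt ℓ) (slotAt-valid ℓ)
    where
    fitSlot : ∀ y → Valid y → width y + width (next y) ≤ suc (suc K)
    fitSlot (slot b j single) _ with j ≟ suc K
    ... | yes _ = +-mono-≤ (width≤ b j single) (≤-trans (width≤ (suc b) 0 single) (s≤s z≤n))
    ... | no _  = +-mono-≤ (width≤ b j single) (≤-trans (width≤ b j tail) (s≤s (m∸n≤m K j)))
    fitSlot (slot b j tail) j≤K = ≤-trans (+-mono-≤ (width≤ b j tail) (width≤ b j head))
      (≤-reflexive (trans (+-suc _ j) (cong suc (trans (cong suc (+-comm (K ∸ j) j)) (cong suc (m+[n∸m]≡n j≤K))))))
    fitSlot (slot b j head) j≤K = ≤-trans (+-mono-≤ (width≤ b j head) (width≤ b (suc j) single))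
      (≤-trans (≤-reflexive (+-comm (suc j) 1)) (s≤s (s≤s j≤K)))

  blockSize : ℕ → ℕ
  blockSize b = ∑ blockLength (λ o → size (fold (slot b 0 single) next o))

  tripleSize : ∀ b i → b < p → i ≤ K →
    ∑ 3 (λ o → size (fold (slot b 0 single) next (i * 3 + o))) ≡ suc (tailSize b i + headSize b i)
  tripleSize b i b<p i≤K = begin
    ∑ 3 (λ o → size (fold (slot b 0 single) next (i * 3 + o)))
      ≡⟨ ∑-cong 3 (λ o _ → cong size (fromTriple o)) ⟩
    size (slot b i single) + (size (next (slot b i single)) + (size (next (next (slot b i single))) + 0))
      ≡⟨ cong (λ x → size (slot b i single) + (size x + (size (next x) + 0))) (next-single b i i≤K) ⟩
    size (slot b i single) + (size (slot b i tail) + (size (slot b i head) + 0))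
      ≡⟨ cong₂ (λ s t → s + (t + (size (slot b i head) + 0))) (single-size i b<p) (size-inside i tail b<p) ⟩
    suc (tailSize b i + (size (slot b i head) + 0))
      ≡⟨ cong (λ h → suc (tailSize b i + h)) (trans (+-identityʳ _) (size-inside i head b<p)) ⟩
    suc (tailSize b i + headSize b i)
      ∎
    where
    open ≡-Reasoning
    fromTriple : ∀ o → fold (slot b 0 single) next (i * 3 + o) ≡ fold (slot b i single) next o
    fromTriple o = begin
      fold (slot b 0 single) next (i * 3 + o)                   ≡⟨ cong (fold (slot b 0 single) next) (+-comm (i * 3) o) ⟩
      fold (slot b 0 single) next (o + i * 3)                   ≡⟨ fold-+ (slot b 0 single) next o {i * 3} ⟩
      fold (fold (slot b 0 single) next (i * 3)) next o         ≡⟨ cong (λ x → fold x next o) (fold-next-triples b 0 i (≤-trans i≤K (n≤1+n K))) ⟩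
      fold (slot b i single) next o                             ∎

  blockShrinks : ∀ b → ∑ (suc K) (shrinks b) ≡ 𝟙 (not (does (b ≟ 0))) + 𝟙 (not (does (suc b ≟ p)))
  blockShrinks b = trans (∑-distrib-+ (suc K) (𝟙 ∘ shrinkTail b) (𝟙 ∘ shrinkHead b))
    (cong₂ _+_ (count-≟-∧ {0} {suc K} z<s (not (does (b ≟ 0)))) (count-≟-∧ {K} {suc K} ≤-refl (not (does (suc b ≟ p)))))

  perBlock : ℕ
  perBlock = suc (suc K) * δ + K

  blockSize-restored : ∀ b → b < p →
    blockSize b + (𝟙 (not (does (b ≟ 0))) + 𝟙 (not (does (suc b ≟ p)))) ≡ perBlock + 2
  blockSize-restored b b<p = begin
    blockSize b + (𝟙 (not (does (b ≟ 0))) + 𝟙 (not (does (suc b ≟ p))))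
      ≡⟨ cong₂ _+_ (∑-suc (suc K * 3) sizeAt) (sym (blockShrinks b)) ⟩
    ∑ (suc K * 3) sizeAt + sizeAt (suc K * 3) + shrunk
      ≡⟨ cong₂ (λ s t → s + size t + shrunk) (∑-blocks (suc K) 3 sizeAt) (fold-next-triples b 0 (suc K) ≤-refl) ⟩
    ∑ (suc K) (λ i → ∑ 3 (λ o → sizeAt (i * 3 + o))) + size (slot b (suc K) single) + shrunk
      ≡⟨ cong₂ (λ s t → s + t + shrunk) (∑-cong (suc K) (λ i i< → tripleSize b i b<p (s≤s⁻¹ i<))) (single-size (suc K) b<p) ⟩
    ∑ (suc K) triple + 1 + shrunk
      ≡⟨ shuffle (∑ (suc K) triple) shrunk ⟩
    ∑ (suc K) triple + shrunk + 1
      ≡⟨ cong (_+ 1) (trans (sym (∑-distrib-+ (suc K) triple (shrinks b))) (∑-cong (suc K) (λ i i< → restore i (s≤s⁻¹ i<)))) ⟩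
    ∑ (suc K) (λ i → suc δ + part i) + 1
      ≡⟨ cong (_+ 1) (trans (∑-distrib-+ (suc K) (λ _ → suc δ) part) (cong₂ _+_ (∑-const (suc K) (suc δ)) ∑part≡δ)) ⟩
    suc K * suc δ + δ + 1
      ≡⟨ arithmetic K δ ⟩
    perBlock + 2
      ∎
    where
    open ≡-Reasoning
    sizeAt : ℕ → ℕ
    sizeAt o = size (fold (slot b 0 single) next o)
    triple : ℕ → ℕ
    triple i = suc (tailSize b i + headSize b i)
    shrunk : ℕ
    shrunk = ∑ (suc K) (shrinks b)
    shuffle : ∀ a c → a + 1 + c ≡ a + c + 1
    shuffle = solve-∀
    arithmetic : ∀ K δ → suc K * suc δ + δ + 1 ≡ suc (suc K) * δ + K + 2
    arithmetic = solve-∀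
    restore : ∀ i → i ≤ K → triple i + shrinks b i ≡ suc δ + part i
    restore i i≤K = cong suc (trans (sym (interchange (tailSize b i) _ (headSize b i) _)) (pair-restored b i i≤K))

  blockSize≡ : ∀ b → b < p → blockSize b ≡ perBlock + 𝟙 (does (b ≟ 0)) + 𝟙 (does (suc b ≟ p))
  blockSize≡ b b<p = 𝟙-complement (blockSize b) perBlock _ _ (blockSize-restored b b<p)

  vertexCount : N ≡ p * perBlock + 2
  vertexCount = begin
    ∑ (p * blockLength) layerSize
      ≡⟨ ∑-blocks p blockLength layerSize ⟩
    ∑ p (λ b → ∑ blockLength (λ o → layerSize (b * blockLength + o)))
      ≡⟨ ∑-cong p (λ b b<p → trans (∑-cong blockLength (λ o _ → cong size (slotAt-inBlock b o))) (blockSize≡ b b<p)) ⟩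
    ∑ p (λ b → perBlock + 𝟙 (does (b ≟ 0)) + 𝟙 (does (suc b ≟ p)))
      ≡⟨ ∑-distrib-+ p (λ b → perBlock + 𝟙 (does (b ≟ 0))) (λ b → 𝟙 (does (suc b ≟ p))) ⟩
    ∑ p (λ b → perBlock + 𝟙 (does (b ≟ 0))) + count p (λ b → does (suc b ≟ p))
      ≡⟨ cong₂ _+_ (trans (∑-distrib-+ p (λ _ → perBlock) (λ b → 𝟙 (does (b ≟ 0))))
                          (cong₂ _+_ (∑-const p perBlock) (count-≟ 0<p)))
                   lastBlock ⟩
    p * perBlock + 1 + 1
      ≡⟨ +-assoc (p * perBlock) 1 1 ⟩
    p * perBlock + 2
      ∎
    where
    open ≡-Reasoning
    lastBlock : count p (λ b → does (suc b ≟ p)) ≡ 1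
    lastBlock = trans (∑-cong p (λ b _ → cong 𝟙 (does-⇔ (mk⇔ (cong pred) (λ e → trans (cong suc e) (suc-pred p {{>-nonZero 0<p}})))
                                                         (suc b ≟ p) (b ≟ pred p))))
                      (count-≟ (∸-monoʳ-< {p} {1} {0} z<s 0<p))

  open Distances nonempty
  open Colouring (suc (suc K)) fit

  properties : Connected graph × Colorable graph (suc (suc K)) × MinDegree graph δ × IsDiameter graph (L ∸ 1)
  properties = (λ u v → L ∸ 1 , reach (<⇒≤ 3<L) u v) , colourable , minDegree δ emptyAfter window≥ tight , diameter (<⇒≤ 3<L)

-- δ = (K + 1) q + ρ + 1 split into K + 1 parts: q + 1 for the first ρ and for the last, q for the others
module BalancedParts (K q ρ : ℕ) (ρ≤K : ρ ≤ K) where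

  part : ℕ → ℕ
  part c = q + 𝟙 (does (c <? ρ) ∨ does (c ≟ K))

  part-last : part K ≡ suc q
  part-last = trans (cong (λ t → q + 𝟙 t) (trans (cong (does (K <? ρ) ∨_) (dec-true (K ≟ K) refl)) (∨-zeroʳ _))) (+-comm q 1)

  part-below : ∀ {c} → c < K → part c ≡ q + 𝟙 (does (c <? ρ))
  part-below {c} c<K = cong (λ t → q + 𝟙 t) (trans (cong (does (c <? ρ) ∨_) (dec-false (c ≟ K) (<⇒≢ c<K))) (∨-identityʳ _))

  ∑part : ∑ (suc K) part ≡ suc K * q + suc ρ
  ∑part = begin
    ∑ (suc K) part                                                   ≡⟨ ∑-distrib-+ (suc K) (λ _ → q) (λ c → 𝟙 (does (c <? ρ) ∨ does (c ≟ K))) ⟩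
    ∑ (suc K) (λ _ → q) + count (suc K) (λ c → does (c <? ρ) ∨ does (c ≟ K))
                                                                     ≡⟨ cong₂ _+_ (∑-const (suc K) q) (∑-suc K (λ c → 𝟙 (does (c <? ρ) ∨ does (c ≟ K)))) ⟩
    suc K * q + (count K (λ c → does (c <? ρ) ∨ does (c ≟ K)) + 𝟙 (does (K <? ρ) ∨ does (K ≟ K)))
      ≡⟨ cong (λ t → suc K * q + t) (cong₂ _+_ (∑-cong K (λ c c<K → +-cancelˡ-≡ q _ _ (part-below c<K)))
                                               (+-cancelˡ-≡ q _ _ (trans part-last (+-comm 1 q)))) ⟩
    suc K * q + (count K (λ c → does (c <? ρ)) + 1)                  ≡⟨ cong (λ t → suc K * q + (t + 1)) (count-< ρ≤K) ⟩
    suc K * q + (ρ + 1)                                              ≡⟨ cong (suc K * q +_) (+-comm ρ 1) ⟩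
    suc K * q + suc ρ                                                ∎
    where open ≡-Reasoning

  part≤1+q : ∀ c → part c ≤ suc q
  part≤1+q c = subst (part c ≤_) (+-comm q 1) (+-monoʳ-≤ q (𝟙≤1 _))
    where
    𝟙≤1 : ∀ t → 𝟙 t ≤ 1
    𝟙≤1 true  = ≤-refl
    𝟙≤1 false = z≤n

  part≤last : ∀ c → c ≤ K → part c ≤ part K
  part≤last c _ = subst (part c ≤_) (sym part-last) (part≤1+q c)

  last≤1+part : ∀ c → c ≤ K → part K ≤ suc (part c)
  last≤1+part c _ = subst (_≤ suc (part c)) (sym part-last) (s≤s (m≤m+n q _))

  part≤first : 0 < K → ∀ c → c < K → part c ≤ part 0
  part≤first 0<K c c<K = subst₂ _≤_ (sym (part-below c<K)) (sym (part-below 0<K)) (+-monoʳ-≤ q (earlier (c <? ρ) (0 <? ρ)))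
    where
    earlier : (c<ρ? : Dec (c < ρ)) (0<ρ? : Dec (0 < ρ)) → 𝟙 (does c<ρ?) ≤ 𝟙 (does 0<ρ?)
    earlier (yes _)   (yes _)   = ≤-refl
    earlier (yes c<ρ) (no 0≮ρ)  = ⊥-elim (0≮ρ (≤-trans (s≤s z≤n) c<ρ))
    earlier (no _)    _         = z≤n

  part-positive : K ≤ suc K * q + ρ → ∀ c → c ≤ K → 0 < part c
  part-positive large c c≤K with 0 <? q
  ... | yes 0<q = ≤-trans 0<q (m≤m+n q _)
  ... | no  0≮q = ≤-trans (subst (0 <_) (sym (cong 𝟙 (lastOrBelow (m≤n⇒m<n∨m≡n c≤K)))) z<s) (m≤n+m _ q)
    where
    K≤ρ : K ≤ ρ
    K≤ρ = subst (K ≤_) (cong (_+ ρ) (*-zeroʳ (suc K))) (subst (λ t → K ≤ suc K * t + ρ) (n≤0⇒n≡0 (≮⇒≥ 0≮q)) large)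
    lastOrBelow : c < K ⊎ c ≡ K → does (c <? ρ) ∨ does (c ≟ K) ≡ true
    lastOrBelow (inj₁ c<K) = cong (_∨ does (c ≟ K)) (dec-true (c <? ρ) (<-≤-trans c<K K≤ρ))
    lastOrBelow (inj₂ c≡K) = trans (cong (does (c <? ρ) ∨_) (dec-true (c ≟ K) c≡K)) (∨-zeroʳ _)

-- Rational arithmetic

open import Data.Integer as ℤ using (ℤ; +_; -_; +<+)
import Data.Integer.Properties as ℤP
import Data.Integer.Tactic.RingSolver as ℤ-Solver
open import Data.Rational as ℚ using (ℚ; mkℚ; ∣_∣)
import Data.Rational.Properties as ℚP
open import Data.Rational.Unnormalised as ℚᵘ using (ℚᵘ; mkℚᵘ; *≡*; *<*)
import Data.Rational.Unnormalised.Properties as ℚᵘP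

toℚᵘ-frac : ∀ a {n} → 1 ≤ n → ℚ.toℚᵘ (frac a n) ℚᵘ.≃ mkℚᵘ a (n ∸ 1)
toℚᵘ-frac a {suc n} _ = ℚP.toℚᵘ-fromℚᵘ (mkℚᵘ a n)

frac<frac⇔ : ∀ a b {n d} → 1 ≤ n → 1 ≤ d → (frac a n ℚ.< frac b d) ⇔ (a ℤ.* + d ℤ.< b ℤ.* + n)
frac<frac⇔ a b {suc n} {suc d} 1≤n 1≤d = mk⇔
  (λ lt → ℚᵘP.drop-*<* (ℚᵘP.<-respʳ-≃ (toℚᵘ-frac b 1≤d) (ℚᵘP.<-respˡ-≃ (toℚᵘ-frac a 1≤n) (ℚP.toℚᵘ-mono-< lt))))
  (λ lt → ℚP.toℚᵘ-cancel-< (ℚᵘP.<-respʳ-≃ (ℚᵘP.≃-sym (toℚᵘ-frac b 1≤d)) (ℚᵘP.<-respˡ-≃ (ℚᵘP.≃-sym (toℚᵘ-frac a 1≤n)) (*<* lt))))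

threshold⇔ : ∀ A B c k K₂ δ → c * B ≡ A * k + 1 → 1 ≤ B → 1 ≤ k * δ + K₂ →
  (frac (+ A) B ℚ.< frac (+ (c * δ)) (k * δ + K₂)) ⇔ (A * K₂ < δ)
threshold⇔ A B c k K₂ δ cB≡ 1≤B 1≤m = mk⇔
  (λ lt → +-cancelˡ-< (A * k * δ) _ _ (ℤP.drop‿+<+ (subst₂ ℤ._<_ lhs rhs (Equivalence.to cross lt))))
  (λ lt → Equivalence.from cross (subst₂ ℤ._<_ (sym lhs) (sym rhs) (+<+ (+-monoʳ-< (A * k * δ) lt))))
  where
  cross : (frac (+ A) B ℚ.< frac (+ (c * δ)) (k * δ + K₂)) ⇔ (+ A ℤ.* + (k * δ + K₂) ℤ.< + (c * δ) ℤ.* + B)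
  cross = frac<frac⇔ (+ A) (+ (c * δ)) 1≤B 1≤m
  lhs : + A ℤ.* + (k * δ + K₂) ≡ + (A * k * δ + A * K₂)
  lhs = trans (sym (ℤP.pos-* A _)) (cong +_ (expand A k δ K₂))
    where
    expand : ∀ A k δ K₂ → A * (k * δ + K₂) ≡ A * k * δ + A * K₂
    expand = solve-∀
  rhs : + (c * δ) ℤ.* + B ≡ + (A * k * δ + δ)
  rhs = trans (sym (ℤP.pos-* (c * δ) B)) (cong +_ (begin
    c * δ * B          ≡⟨ swap c δ B ⟩
    c * B * δ          ≡⟨ cong (_* δ) cB≡ ⟩
    (A * k + 1) * δ    ≡⟨ expand (A * k) δ ⟩
    A * k * δ + δ      ∎))
    where
    open ≡-Reasoning
    swap : ∀ c δ B → c * δ * B ≡ c * B * δ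
    swap = solve-∀
    expand : ∀ a δ → (a + 1) * δ ≡ a * δ + δ
    expand = solve-∀

toℚᵘ-frac-sub-sub : ∀ a c e n {x y z d} → 1 ≤ x → 1 ≤ y → 1 ≤ z → 1 ≤ d →
  ((a ℤ.* + y ℤ.+ (ℤ.- c) ℤ.* + x) ℤ.* + z ℤ.+ (ℤ.- e) ℤ.* (+ x ℤ.* + y)) ℤ.* + d
    ≡ n ℤ.* (+ x ℤ.* + y ℤ.* + z) →
  ℚ.toℚᵘ ((frac a x ℚ.- frac c y) ℚ.- frac e z) ℚᵘ.≃ mkℚᵘ n (d ∸ 1)
toℚᵘ-frac-sub-sub a c e n {suc x} {suc y} {suc z} {suc d} 1≤x 1≤y 1≤z _ eq = ℚᵘP.≃-trans homomorphic (*≡* eq)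
  where
  F G H : ℚ
  F = frac a (suc x)
  G = frac c (suc y)
  H = frac e (suc z)
  homomorphic : ℚ.toℚᵘ ((F ℚ.- G) ℚ.- H) ℚᵘ.≃ (mkℚᵘ a x ℚᵘ.- mkℚᵘ c y) ℚᵘ.- mkℚᵘ e z
  homomorphic = ℚᵘP.≃-trans (ℚP.toℚᵘ-homo-+ (F ℚ.- G) (ℚ.- H)) (ℚᵘP.+-cong
    (ℚᵘP.≃-trans (ℚP.toℚᵘ-homo-+ F (ℚ.- G)) (ℚᵘP.+-cong (toℚᵘ-frac a 1≤x) (ℚᵘP.≃-trans (ℚP.toℚᵘ-homo‿- G) (ℚᵘP.-‿cong (toℚᵘ-frac c 1≤y)))))
    (ℚᵘP.≃-trans (ℚP.toℚᵘ-homo‿- H) (ℚᵘP.-‿cong (toℚᵘ-frac e 1≤z))))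

-- Both sides depend on C only through C·B, which the hypothesis replaces by A·k + 1.
difference-identity : ∀ {C Δ B A k K₂ M BK MK CΔ CK₂} →
  M ≡ k ℤ.* Δ ℤ.+ K₂ → BK ≡ B ℤ.* k → MK ≡ M ℤ.* k → CΔ ≡ C ℤ.* Δ → CK₂ ≡ C ℤ.* K₂ → C ℤ.* B ≡ A ℤ.* k ℤ.+ + 1 →
  ((CΔ ℤ.* B ℤ.+ (ℤ.- A) ℤ.* M) ℤ.* BK ℤ.+ (ℤ.- + 1) ℤ.* (M ℤ.* B)) ℤ.* MK ≡ (ℤ.- CK₂) ℤ.* (M ℤ.* B ℤ.* BK)
difference-identity {C} {Δ} {B} {A} {k} {K₂} refl refl refl refl refl cB≡ = begin
  _                      ≡⟨ throughCB C Δ B A k K₂ ⟩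
  lhs (C ℤ.* B)          ≡⟨ cong lhs cB≡ ⟩
  lhs (A ℤ.* k ℤ.+ + 1)  ≡⟨ substituted Δ B A k K₂ ⟩
  rhs (A ℤ.* k ℤ.+ + 1)  ≡⟨ cong rhs (sym cB≡) ⟩
  rhs (C ℤ.* B)          ≡⟨ sym (throughCB′ C Δ B A k K₂) ⟩
  _                      ∎
  where
  open ≡-Reasoning
  M = k ℤ.* Δ ℤ.+ K₂
  lhs rhs : ℤ → ℤ
  lhs P = ((Δ ℤ.* P ℤ.+ (ℤ.- A) ℤ.* M) ℤ.* (B ℤ.* k) ℤ.+ (ℤ.- + 1) ℤ.* (M ℤ.* B)) ℤ.* (M ℤ.* k)
  rhs P = (ℤ.- (K₂ ℤ.* P)) ℤ.* (M ℤ.* (B ℤ.* k))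
  throughCB : ∀ C Δ B A k K₂ →
    ((C ℤ.* Δ ℤ.* B ℤ.+ (ℤ.- A) ℤ.* (k ℤ.* Δ ℤ.+ K₂)) ℤ.* (B ℤ.* k) ℤ.+ (ℤ.- + 1) ℤ.* ((k ℤ.* Δ ℤ.+ K₂) ℤ.* B)) ℤ.* ((k ℤ.* Δ ℤ.+ K₂) ℤ.* k)
      ≡ ((Δ ℤ.* (C ℤ.* B) ℤ.+ (ℤ.- A) ℤ.* (k ℤ.* Δ ℤ.+ K₂)) ℤ.* (B ℤ.* k) ℤ.+ (ℤ.- + 1) ℤ.* ((k ℤ.* Δ ℤ.+ K₂) ℤ.* B)) ℤ.* ((k ℤ.* Δ ℤ.+ K₂) ℤ.* k)
  throughCB = ℤ-Solver.solve-∀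
  throughCB′ : ∀ C Δ B A k K₂ →
    (ℤ.- (C ℤ.* K₂)) ℤ.* ((k ℤ.* Δ ℤ.+ K₂) ℤ.* B ℤ.* (B ℤ.* k)) ≡ (ℤ.- (K₂ ℤ.* (C ℤ.* B))) ℤ.* ((k ℤ.* Δ ℤ.+ K₂) ℤ.* (B ℤ.* k))
  throughCB′ = ℤ-Solver.solve-∀
  substituted : ∀ Δ B A k K₂ →
    ((Δ ℤ.* (A ℤ.* k ℤ.+ + 1) ℤ.+ (ℤ.- A) ℤ.* (k ℤ.* Δ ℤ.+ K₂)) ℤ.* (B ℤ.* k) ℤ.+ (ℤ.- + 1) ℤ.* ((k ℤ.* Δ ℤ.+ K₂) ℤ.* B)) ℤ.* ((k ℤ.* Δ ℤ.+ K₂) ℤ.* k)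
      ≡ (ℤ.- (K₂ ℤ.* (A ℤ.* k ℤ.+ + 1))) ℤ.* ((k ℤ.* Δ ℤ.+ K₂) ℤ.* (B ℤ.* k))
  substituted = ℤ-Solver.solve-∀

difference≃ : ∀ A B c k K₂ δ → c * B ≡ A * k + 1 → 1 ≤ B → 1 ≤ k → 1 ≤ K₂ →
  ℚ.toℚᵘ ((frac (+ (c * δ)) (k * δ + K₂) ℚ.- frac (+ A) B) ℚ.- frac (+ 1) (B * k))
    ℚᵘ.≃ mkℚᵘ (ℤ.- + (c * K₂)) ((k * δ + K₂) * k ∸ 1)
difference≃ A B c k K₂ δ cB≡ 1≤B 1≤k 1≤K₂ =
  toℚᵘ-frac-sub-sub _ _ _ _ 1≤m 1≤B (*-mono-≤ 1≤B 1≤k) (*-mono-≤ 1≤m 1≤k)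
    (difference-identity {+ c} {+ δ} {+ B} {+ A} {+ k} {+ K₂} (trans (ℤP.pos-+ (k * δ) K₂) (cong (ℤ._+ + K₂) (ℤP.pos-* k δ)))
                         (ℤP.pos-* B k) (ℤP.pos-* m k) (ℤP.pos-* c δ) (ℤP.pos-* c K₂) cB≡ℤ)
  where
  m : ℕ
  m = k * δ + K₂
  1≤m : 1 ≤ m
  1≤m = ≤-trans 1≤K₂ (m≤n+m K₂ (k * δ))
  cB≡ℤ : + c ℤ.* + B ≡ + A ℤ.* + k ℤ.+ + 1
  cB≡ℤ = trans (sym (ℤP.pos-* c B)) (trans (cong +_ cB≡) (trans (ℤP.pos-+ (A * k) 1) (cong (ℤ._+ + 1) (ℤP.pos-* A k))))

difference→0 : ∀ A B c k K₂ → c * B ≡ A * k + 1 → 1 ≤ B → 1 ≤ k → 1 ≤ K₂ →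
  ∀ (ε : ℚ) → ℚ.0ℚ ℚ.< ε → ∃ λ (Δ : ℕ) → ∀ (δ : ℕ) → Δ ≤ δ →
    ℚ.∣ (frac (+ (c * δ)) (k * δ + K₂) ℚ.- frac (+ A) B) ℚ.- frac (+ 1) (B * k) ∣ ℚ.< ε
difference→0 A B c k K₂ cB≡ 1≤B 1≤k 1≤K₂ (mkℚ (+ 0) _ _)     (ℚ.*<* (+<+ ()))
difference→0 A B c k K₂ cB≡ 1≤B 1≤k 1≤K₂ (mkℚ ℤ.-[1+ _ ] _ _) (ℚ.*<* ())
difference→0 A B c k K₂ cB≡ 1≤B 1≤k 1≤K₂ ε@(mkℚ (+ suc n) d _) _ = c * K₂ * suc d , small
  where
  small : ∀ δ → c * K₂ * suc d ≤ δ → ℚ.∣ (frac (+ (c * δ)) (k * δ + K₂) ℚ.- frac (+ A) B) ℚ.- frac (+ 1) (B * k) ∣ ℚ.< ε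
  small δ Δ≤δ = ℚP.toℚᵘ-cancel-< (ℚᵘP.<-respˡ-≃ (ℚᵘP.≃-sym absolute) (*<* (subst₂ ℤ._<_ (ℤP.pos-* (c * K₂) (suc d)) (ℤP.pos-* (suc n) _) (+<+ below))))
    where
    m : ℕ
    m = k * δ + K₂
    1≤mk : 1 ≤ m * k
    1≤mk = *-mono-≤ (≤-trans 1≤K₂ (m≤n+m K₂ (k * δ))) 1≤k
    absolute : ℚ.toℚᵘ (ℚ.∣ (frac (+ (c * δ)) m ℚ.- frac (+ A) B) ℚ.- frac (+ 1) (B * k) ∣) ℚᵘ.≃ mkℚᵘ (+ (c * K₂)) (m * k ∸ 1)
    absolute = ℚᵘP.≃-trans (ℚP.toℚᵘ-homo-∣-∣ _) (ℚᵘP.≃-trans (ℚᵘP.∣-∣-cong (difference≃ A B c k K₂ δ cB≡ 1≤B 1≤k 1≤K₂))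
                 (ℚᵘP.≃-reflexive (cong (λ t → mkℚᵘ (+ t) (m * k ∸ 1)) (ℤP.∣-i∣≡∣i∣ (+ (c * K₂))))))
    below : c * K₂ * suc d < suc n * suc (m * k ∸ 1)
    below = begin-strict
      c * K₂ * suc d          ≤⟨ Δ≤δ ⟩
      δ                       <⟨ subst (_≤ m) (+-comm δ 1) (+-mono-≤ (m≤n*m δ k {{>-nonZero 1≤k}}) 1≤K₂) ⟩
      k * δ + K₂              ≤⟨ m≤m*n m k {{>-nonZero 1≤k}} ⟩
      m * k                   ≤⟨ m≤n*m (m * k) (suc n) ⟩
      suc n * (m * k)         ≡⟨ cong (suc n *_) (sym (suc-pred (m * k) {{>-nonZero 1≤mk}})) ⟩
      suc n * suc (m * k ∸ 1) ∎
      where open ≤-Reasoning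

diameter-deviation : ∀ P p m → 1 ≤ p * P → 1 ≤ m →
  ℤ.∣ + ((p * P ∸ 1) * m) ℤ.- + (P * (p * m + 2)) ∣ ≤ (1 + 2 * P) * m
diameter-deviation P p m 1≤pP 1≤m = begin
  ℤ.∣ + a ℤ.- + b ∣     ≡⟨ cong ℤ.∣_∣ (ℤP.[+m]-[+n]≡m⊖n a b) ⟩
  ℤ.∣ a ℤ.⊖ b ∣         ≡⟨ ℤP.∣⊖∣-≤ (subst (a ≤_) a+gap≡b (m≤m+n a _)) ⟩
  b ∸ a                  ≡⟨ trans (cong (_∸ a) (sym a+gap≡b)) (m+n∸m≡n a _) ⟩
  m + 2 * P              ≤⟨ +-monoʳ-≤ m (m≤m*n (2 * P) m {{>-nonZero 1≤m}}) ⟩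
  m + 2 * P * m          ≡⟨ sym (expand P m) ⟩
  (1 + 2 * P) * m        ∎
  where
  open ≤-Reasoning
  a b : ℕ
  a = (p * P ∸ 1) * m
  b = P * (p * m + 2)
  expand : ∀ P m → (1 + 2 * P) * m ≡ m + 2 * P * m
  expand = solve-∀
  regroup : ∀ P p m → p * P * m + 2 * P ≡ P * (p * m + 2)
  regroup = solve-∀
  a+gap≡b : a + (m + 2 * P) ≡ b
  a+gap≡b = begin-equality
    a + (m + 2 * P)          ≡⟨ sym (+-assoc a m (2 * P)) ⟩
    a + m + 2 * P            ≡⟨ cong (_+ 2 * P) (trans (+-comm a m) (cong (_* m) (suc-pred (p * P) {{>-nonZero 1≤pP}}))) ⟩
    p * P * m + 2 * P        ≡⟨ regroup P p m ⟩
    b                        ∎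

[+m]-[+n]<⇔ : ∀ m n δ → (+ (m + n) ℤ.- + m ℤ.< + δ) ⇔ (n < δ)
[+m]-[+n]<⇔ m n δ = mk⇔ (ℤP.drop‿+<+ ∘ subst (ℤ._< + δ) difference) (subst (ℤ._< + δ) (sym difference) ∘ +<+)
  where
  difference : + (m + n) ℤ.- + m ≡ + n
  difference = trans (ℤP.[+m]-[+n]≡m⊖n (m + n) m) (trans (ℤP.⊖-≥ (m≤m+n m n)) (cong +_ (m+n∸m≡n m n)))

GraphWith : ℕ → ℕ → ℕ → (ℕ → Set) → Set
GraphWith n c δ Bound =
  Σ (Graph n) λ G → Connected G × Colorable G c × MinDegree G δ × ∃ λ D → IsDiameter G D × Bound D

module Constants (s : ℕ) where

  r K A B c k : ℕ
  r = 2 + s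
  K = 2 * r ∸ 3
  A = 2 * (r ∸ 1) * (3 * r + 2)
  B = 2 * r * r ∸ 1
  c = 6 * r ∸ 5
  k = 2 * r ∸ 1

  2r≡ : 2 * r ≡ 4 + 2 * s
  2r≡ = double s
    where
    double : ∀ s → 2 * (2 + s) ≡ 4 + 2 * s
    double = solve-∀

  K≡ : K ≡ suc (2 * s)
  K≡ = cong (_∸ 3) 2r≡

  k≡ : k ≡ suc (suc K)
  k≡ = trans (cong (_∸ 1) 2r≡) (cong (suc ∘ suc) (sym K≡))

  2r∸2≡ : 2 * r ∸ 2 ≡ suc K
  2r∸2≡ = trans (cong (_∸ 2) 2r≡) (cong suc (sym K≡))

  c≡ : c ≡ suc (suc K * 3)
  c≡ = trans (cong (_∸ 5) (sixfold s)) (trans (m+n∸m≡n 5 _) (cong (λ K → suc (suc K * 3)) (sym K≡)))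
    where
    sixfold : ∀ s → 6 * (2 + s) ≡ 5 + suc (suc (suc (2 * s)) * 3)
    sixfold = solve-∀

  B≡ : B ≡ 7 + 8 * s + 2 * s * s
  B≡ = trans (cong (_∸ 1) (square s)) (m+n∸m≡n 1 _)
    where
    square : ∀ s → 2 * (2 + s) * (2 + s) ≡ 1 + (7 + 8 * s + 2 * s * s)
    square = solve-∀

  0<K : 0 < K
  0<K = subst (0 <_) (sym K≡) z<s

  1≤B : 1 ≤ B
  1≤B = subst (1 ≤_) (sym B≡) (s≤s z≤n)

  1≤k : 1 ≤ k
  1≤k = subst (1 ≤_) (sym k≡) (s≤s z≤n)

  cB≡Ak+1 : c * B ≡ A * k + 1
  cB≡Ak+1 = trans (cong₂ _*_ (trans c≡ (cong (λ K → suc (suc K * 3)) K≡)) B≡)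
                  (trans (expand s) (cong (λ k → A * k + 1) (sym (trans k≡ (cong (suc ∘ suc) K≡)))))
    where
    expand : ∀ s → suc (suc (suc (2 * s)) * 3) * (7 + 8 * s + 2 * s * s) ≡ 2 * suc s * (3 * (2 + s) + 2) * suc (suc (suc (2 * s))) + 1
    expand = solve-∀

  factorisation : 12 * r * r * r + 12 ≡ 22 * r * r + 2 * r + A * K
  factorisation = trans (expand s) (cong (λ K → 22 * r * r + 2 * r + A * K) (sym K≡))
    where
    expand : ∀ s → 12 * (2 + s) * (2 + s) * (2 + s) + 12 ≡ 22 * (2 + s) * (2 + s) + 2 * (2 + s) + 2 * suc s * (3 * (2 + s) + 2) * suc (2 * s)
    expand = solve-∀

  M : ℕ → ℕ
  M δ = k * δ + K

  graphs : ∀ δ p → 2 * r ∸ 2 ≤ δ → 1 ≤ p →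
    GraphWith (p * M δ + 2) k δ (λ D → ℤ.∣ + (D * M δ) ℤ.- + (c * (p * M δ + 2)) ∣ ≤ (1 + 2 * c) * M δ)
  graphs δ p δ≥ 1≤p = let (connected , colourable , minimum , diameter) = properties in
    subst₂ (λ n colours → GraphWith n colours δ (λ D → ℤ.∣ + (D * M δ) ℤ.- + (c * (p * M δ + 2)) ∣ ≤ (1 + 2 * c) * M δ))
      vertices (sym k≡) (graph , connected , colourable , minimum , L ∸ 1 , diameter , deviation)
    where
    1+K≤δ : suc K ≤ δ
    1+K≤δ = subst (_≤ δ) 2r∸2≡ δ≥
    d q ρ : ℕ
    d = δ ∸ 1
    q = d / suc K
    ρ = d % suc K
    δ≡ : δ ≡ suc K * q + suc ρ
    δ≡ = begin
      δ                    ≡⟨ sym (suc-pred δ {{>-nonZero (≤-trans (s≤s z≤n) 1+K≤δ)}}) ⟩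
      suc d                ≡⟨ cong suc (m≡m%n+[m/n]*n d (suc K)) ⟩
      suc (ρ + q * suc K)  ≡⟨ rearrange ρ q K ⟩
      suc K * q + suc ρ    ∎
      where
      open ≡-Reasoning
      rearrange : ∀ ρ q K → suc (ρ + q * suc K) ≡ suc K * q + suc ρ
      rearrange = solve-∀
    open BalancedParts K q ρ (s≤s⁻¹ (m%n<n d (suc K)))
    large : K ≤ suc K * q + ρ
    large = s≤s⁻¹ (subst (suc K ≤_) (trans δ≡ (+-suc _ ρ)) 1+K≤δ)
    open Construction K p δ part 0<K 1≤p (trans ∑part (sym δ≡)) (part-positive large) part≤last last≤1+part (part≤first 0<K)
    vertices : N ≡ p * M δ + 2
    vertices = trans vertexCount (cong (λ k′ → p * (k′ * δ + K) + 2) (sym k≡))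
    deviation : ℤ.∣ + ((L ∸ 1) * M δ) ℤ.- + (c * (p * M δ + 2)) ∣ ≤ (1 + 2 * c) * M δ
    deviation = subst (λ P → ℤ.∣ + ((L ∸ 1) * M δ) ℤ.- + (P * (p * M δ + 2)) ∣ ≤ (1 + 2 * P) * M δ) (sym c≡)
      (diameter-deviation (Slots.blockLength K) p (M δ) (*-mono-≤ 1≤p (s≤s z≤n)) (≤-trans 0<K (m≤n+m K (k * δ))))

  threshold : ∀ δ → 2 * r ∸ 2 ≤ δ →
    (frac (+ A) B ℚ.< frac (+ (c * δ)) (k * δ + K)) ⇔ ((+ (12 * r * r * r + 12)) ℤ.- (+ (22 * r * r + 2 * r)) ℤ.< + δ)
  threshold δ _ = ⇔.trans (threshold⇔ A B c k K δ cB≡Ak+1 1≤B (≤-trans 0<K (m≤n+m K (k * δ))))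
    (⇔.sym (subst (λ X → (+ X ℤ.- + (22 * r * r + 2 * r) ℤ.< + δ) ⇔ (A * K < δ)) (sym factorisation)
      ([+m]-[+n]<⇔ (22 * r * r + 2 * r) (A * K) δ)))

theorem3p2 : ∀ (r : ℕ) → 2 ≤ r →
    (∃ λ (C : ℕ) → ∀ (δ p : ℕ) → 2 * r ∸ 2 ≤ δ → 1 ≤ p →
      Σ (Graph (p * ((2 * r ∸ 1) * δ + (2 * r ∸ 3)) + 2)) λ G →
        Connected G × Colorable G (2 * r ∸ 1) × MinDegree G δ ×
        ∃ λ (D : ℕ) → IsDiameter G D ×
          ℤ.∣ (+ (D * ((2 * r ∸ 1) * δ + (2 * r ∸ 3))))
              ℤ.- (+ ((6 * r ∸ 5) * (p * ((2 * r ∸ 1) * δ + (2 * r ∸ 3)) + 2))) ∣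
            ≤ C * ((2 * r ∸ 1) * δ + (2 * r ∸ 3)))
    ×
    (∀ (δ : ℕ) → 2 * r ∸ 2 ≤ δ →
      (frac (+ (2 * (r ∸ 1) * (3 * r + 2))) (2 * r * r ∸ 1)
         ℚ.< frac (+ ((6 * r ∸ 5) * δ)) ((2 * r ∸ 1) * δ + (2 * r ∸ 3)))
      ⇔ ((+ (12 * r * r * r + 12)) ℤ.- (+ (22 * r * r + 2 * r)) ℤ.< + δ))
    ×
    (12 * r * r * r + 12 ≡ 22 * r * r + 2 * r + 2 * (r ∸ 1) * (3 * r + 2) * (2 * r ∸ 3))
    ×
    (∀ (ε : ℚ) → ℚ.0ℚ ℚ.< ε → ∃ λ (Δ : ℕ) → ∀ (δ : ℕ) → Δ ≤ δ →
      ∣ (frac (+ ((6 * r ∸ 5) * δ)) ((2 * r ∸ 1) * δ + (2 * r ∸ 3))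
          ℚ.- frac (+ (2 * (r ∸ 1) * (3 * r + 2))) (2 * r * r ∸ 1))
        ℚ.- frac (+ 1) ((2 * r * r ∸ 1) * (2 * r ∸ 1)) ∣ ℚ.< ε)
theorem3p2 (suc (suc s)) _ =
  (1 + 2 * c , graphs) , threshold , factorisation , difference→0 A B c k K cB≡Ak+1 1≤B 1≤k 0<K
  where open Constants s
theorem3p2 (suc zero) (s≤s ())
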